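{- For every integer $n\ge 1$: $\operatorname{T}(K_a(4n-2))=\operatorname{T}(K_a(4n))$, $\operatorname{T}(K_a(4n-1))=\operatorname{T}(K_a(4n+1))$, $\operatorname{T}(K_{na}(4n))=\operatorname{T}(K_{na}(4n+2))$, and $\operatorname{T}(K_{na}(4n+1))=\operatorname{T}(K_{na}(4n+3))$.
   Context: A domino is the union of two lattice unit squares sharing an edge; $\operatorname{T}(X)$ is the number of domino tilings of a region $X$ (the empty region has one tiling). For integers $a,b$ let $S_{a,b}=[a,a+1]\times[b,b+1]$. The Aztec diamond of order $n$ is the union of the squares $S_{a,b}$ with $|a+\tfrac12|+|b+\tfrac12|\le n$. The abutting quartered Aztec diamond $K_a(n)$ is the union of the squares $S_{a,b}$ of the Aztec diamond of order $n$ with $b\ge 2\,|\lceil a/2\rceil|$; the non-abutting quartered Aztec diamond $K_{na}(n)$ is the union of the squares $S_{a,b}$ of the Aztec diamond of order $n$ with $-2\lceil a/2\rceil\le b\le 2\lceil a/2\rceil-1$. -}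

module Defs where

open import Data.Nat as ℕ using (ℕ; zero; suc)
open import Data.Integer as ℤ using (ℤ; +_; -[1+_]; ∣_∣)
open import Data.Bool using (Bool; true; false; _∧_; _∨_; if_then_else_)
open import Data.List using (List; []; _∷_; _++_; map; filterᵇ; length; concatMap; upTo; all; any)
open import Data.Product using (_×_; _,_; proj₁; proj₂)
open import Relation.Nullary.Decidable using (⌊_⌋)

-- A cell (a , b) stands for the unit square S_{a,b} = [a,a+1] × [b,b+1].
Cell : Set
Cell = ℤ × ℤ

-- A region is given by the (duplicate-free) list of its unit cells.
Region : Set
Region = List Cell

-- A domino is an unordered pair of edge-adjacent cells; we store it as
-- (c , c + (1,0)) or (c , c + (0,1)).
Domino : Set
Domino = Cell × Cell

_==ᶜ_ : Cell → Cell → Bool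
(a , b) ==ᶜ (c , d) = ⌊ a ℤ.≟ c ⌋ ∧ ⌊ b ℤ.≟ d ⌋

_∈ᵇ_ : Cell → Region → Bool
c ∈ᵇ X = any (c ==ᶜ_) X

dominoesIn : Region → List Domino
dominoesIn X = concatMap step X
  where
  step : Cell → List Domino
  step (a , b) =
    (if ((a ℤ.+ ℤ.1ℤ) , b) ∈ᵇ X then ((a , b) , ((a ℤ.+ ℤ.1ℤ) , b)) ∷ [] else [])
    ++ (if (a , (b ℤ.+ ℤ.1ℤ)) ∈ᵇ X then ((a , b) , (a , (b ℤ.+ ℤ.1ℤ))) ∷ [] else [])

-- all sublists (= all subsets, for a duplicate-free list)
subsets : {A : Set} → List A → List (List A)
subsets [] = [] ∷ []
subsets (x ∷ xs) = subsets xs ++ map (x ∷_) (subsets xs)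

covers : Cell → Domino → Bool
covers c (c₁ , c₂) = (c ==ᶜ c₁) ∨ (c ==ᶜ c₂)

isTiling : Region → List Domino → Bool
isTiling X D = all (λ c → length (filterᵇ (covers c) D) ℕ.≡ᵇ 1) X

T : Region → ℕ
T X = length (filterᵇ (isTiling X) (subsets (dominoesIn X)))

range : ℕ → List ℤ
range n = map (λ i → (+ i) ℤ.- (+ n)) (upTo (2 ℕ.* n))

grid : ℕ → List Cell
grid n = concatMap (λ a → map (λ b → (a , b)) (range n)) (range n)

-- |a + 1/2| + |b + 1/2| ≤ n   ⇔   |2a+1| + |2b+1| ≤ 2n
inAztec : ℕ → Cell → Bool
inAztec n (a , b) =
  (∣ (+ 2) ℤ.* a ℤ.+ ℤ.1ℤ ∣ ℕ.+ ∣ (+ 2) ℤ.* b ℤ.+ ℤ.1ℤ ∣) ℕ.≤ᵇ (2 ℕ.* n)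

⌈_/2⌉ : ℤ → ℤ
⌈ + m /2⌉ = + ((suc m) ℕ./ 2)
⌈ -[1+ m ] /2⌉ = ℤ.- (+ ((suc m) ℕ./ 2))

_≤ᶻ_ : ℤ → ℤ → Bool
x ≤ᶻ y = ⌊ x ℤ.≤? y ⌋

Ka : ℕ → Region
Ka n = filterᵇ (λ c → inAztec n c ∧ ((+ (2 ℕ.* ∣ ⌈ proj₁ c /2⌉ ∣)) ≤ᶻ proj₂ c)) (grid n)

Kna : ℕ → Region
Kna n = filterᵇ (λ c → inAztec n c
                     ∧ ((ℤ.- ((+ 2) ℤ.* ⌈ proj₁ c /2⌉)) ≤ᶻ proj₂ c)
                     ∧ (proj₂ c ≤ᶻ ((+ 2) ℤ.* ⌈ proj₁ c /2⌉ ℤ.- ℤ.1ℤ)))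
                (grid n)

module Submission where

open import Defs
open import Data.Nat using (ℕ; _+_; _*_; _∸_; _≤_)
open import Data.Product using (_×_)
open import Relation.Binary.PropositionalEquality using (_≡_)

open import Data.Nat using (zero; suc; _<_; z≤n; s≤s; _≤ᵇ_; _≡ᵇ_; _/_)
import Data.Nat.Properties as ℕP
open import Algebra.Properties.CommutativeSemigroup ℕP.+-commutativeSemigroup using (x∙yz≈y∙xz)
import Data.Nat.DivMod as DM
open import Data.Nat.Tactic.RingSolver using (solve-∀)
open import Data.Integer as ℤ using (ℤ; +_; -[1+_]; ∣_∣)
import Data.Integer.Properties as ℤP
open import Data.Bool using (Bool; true; false; _∧_; _∨_; not; if_then_else_) renaming (T to True)
import Data.Bool.Properties as BP
open import Data.List using (List; []; _∷_; _++_; map; filterᵇ; length; concatMap; all; applyUpTo; cartesianProduct; _∷ʳ_)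
import Data.List.Properties as LP
open import Data.List.Membership.Propositional using (_∈_; _∉_)
import Data.List.Membership.Propositional.Properties as MP
open import Data.List.Relation.Unary.Any using (Any; here; there)
open import Data.List.Relation.Unary.All as All using (All; []; _∷_)
import Data.List.Relation.Unary.All.Properties as AllP
open import Data.List.Relation.Unary.AllPairs using ([]; _∷_)
open import Data.List.Relation.Unary.Unique.Propositional using (Unique)
import Data.List.Relation.Unary.Unique.Propositional.Properties as UP
open import Data.Product using (Σ; _,_; proj₁; proj₂)
open import Data.Sum using (_⊎_; inj₁; inj₂) renaming (map to ⊎-map)
open import Data.Empty using (⊥; ⊥-elim)
open import Data.Unit using (⊤; tt)
open import Function using (_∘_)
open import Relation.Binary.PropositionalEquality using (refl; sym; trans; cong; cong₂; subst; subst₂; module ≡-Reasoning)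
open import Relation.Nullary using (yes; no)
open import Relation.Nullary.Decidable using (⌊_⌋; T?; ⌊⌋-map′)

-- Each of the four identities has the shape T(K(m)) = T(K(m+2)).  The proof
-- peels the band K(m+2) ∖ K(m) (the cells with |a+½|+|b+½| ∈ {m+½, m+1½})
-- off K(m+2) one domino at a time, always removing a forced domino.
--
-- If every domino of a region X that
--     covers a cell c is w, then every tiling of X contains w and removing it
--     is a bijection onto the tilings of X ∖ w, so T(X) = T(X ∖ w).  With x = |a+½|-½ and y = |b+½|-½ the Aztec condition
--     reads x + y < n, and the quartering conditions read y ≥ evenCeil x (Ka,
--     b ≥ 0) and y < evenCeil x (Kna, a ≥ 0), where evenCeil x is x rounded up
--     to an even number.
--  4. Peeling the band.  For Ka the band consists of two staircases of
--     horizontal dominoes ('AbuttingBand'), for Kna of two staircases of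
--     vertical dominoes and one domino at the tip ('NonAbuttingBand'); they are
--     removed in an order in which each one is forced.  This gives
--     T(Ka m) = T(Ka (m+2)) when m + 1 = R + evenCeil R ('Ka-shift') and the
--     analogous statement for Kna ('Kna-shift'); the theorem is the case
--     m = 4n-2, 4n-1 for Ka and m = 4n, 4n+1 for Kna.

true≢false : true ≡ false → ⊥
true≢false ()

∨-true : ∀ {a b : Bool} → a ∨ b ≡ true → a ≡ true ⊎ b ≡ true
∨-true {true} _ = inj₁ refl
∨-true {false} p = inj₂ p

∧-true-left : ∀ {a b : Bool} → a ∧ b ≡ true → a ≡ true
∧-true-left {true} _ = refl

≢true⇒false : ∀ b → (b ≡ true → ⊥) → b ≡ false
≢true⇒false b = BP.¬-not {b} {true}

≤ᵇ-true : ∀ {m n} → m ≤ n → (m ≤ᵇ n) ≡ true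
≤ᵇ-true {m} {n} le with m ≤ᵇ n | ℕP.≤⇒≤ᵇ le
... | true | _ = refl
... | false | ()

≤ᵇ-true⇒≤ : ∀ m n → (m ≤ᵇ n) ≡ true → m ≤ n
≤ᵇ-true⇒≤ m n e = ℕP.≤ᵇ⇒≤ m n (subst True (sym e) _)

≤ᵇ-false : ∀ {m n} → n < m → (m ≤ᵇ n) ≡ false
≤ᵇ-false {m} {n} lt = ≢true⇒false (m ≤ᵇ n) (λ e → ℕP.<⇒≱ lt (≤ᵇ-true⇒≤ m n e))

≤ᵇ-false⇒> : ∀ m n → (m ≤ᵇ n) ≡ false → n < m
≤ᵇ-false⇒> m n e = ℕP.≰⇒> (λ le → true≢false (trans (sym (≤ᵇ-true le)) e))

filterᵇ-++ : ∀ {A : Set} (P : A → Bool) xs ys → filterᵇ P (xs ++ ys) ≡ filterᵇ P xs ++ filterᵇ P ys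
filterᵇ-++ P = LP.filter-++ (T? ∘ P)

filterᵇ-map : ∀ {A B : Set} (P : B → Bool) (f : A → B) xs →
  filterᵇ P (map f xs) ≡ map f (filterᵇ (P ∘ f) xs)
filterᵇ-map P f [] = refl
filterᵇ-map P f (x ∷ xs) with P (f x)
... | true = cong (f x ∷_) (filterᵇ-map P f xs)
... | false = filterᵇ-map P f xs

filterᵇ-cong : ∀ {A : Set} (P Q : A → Bool) xs → (∀ x → P x ≡ Q x) → filterᵇ P xs ≡ filterᵇ Q xs
filterᵇ-cong P Q [] h = refl
filterᵇ-cong P Q (x ∷ xs) h with P x | Q x | h x
... | true | true | refl = cong (x ∷_) (filterᵇ-cong P Q xs h)
... | false | false | refl = filterᵇ-cong P Q xs h

filterᵇ-reject : ∀ {A : Set} (P : A → Bool) y ys → P y ≡ false → filterᵇ P (y ∷ ys) ≡ filterᵇ P ys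
filterᵇ-reject P y ys e with P y
... | false = refl

filterᵇ-none : ∀ {A : Set} (P : A → Bool) xs → (∀ x → P x ≡ false) → filterᵇ P xs ≡ []
filterᵇ-none P [] h = refl
filterᵇ-none P (x ∷ xs) h = trans (filterᵇ-reject P x xs (h x)) (filterᵇ-none P xs h)

filterᵇ-filterᵇ : ∀ {A : Set} (P Q : A → Bool) xs → filterᵇ Q (filterᵇ P xs) ≡ filterᵇ (λ x → P x ∧ Q x) xs
filterᵇ-filterᵇ P Q [] = refl
filterᵇ-filterᵇ P Q (x ∷ xs) with P x
... | false = filterᵇ-filterᵇ P Q xs
... | true with Q x
...   | true = cong (x ∷_) (filterᵇ-filterᵇ P Q xs)
...   | false = filterᵇ-filterᵇ P Q xs

filterᵇ-if : ∀ {A : Set} (P : A → Bool) (b : Bool) x →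
  filterᵇ P (if b then x ∷ [] else []) ≡ (if (b ∧ P x) then x ∷ [] else [])
filterᵇ-if P false x = refl
filterᵇ-if P true x with P x
... | true = refl
... | false = refl

filterᵇ-concatMap-cong : ∀ {A B : Set} (P : B → Bool) (F G : A → List B) xs →
  (∀ a → filterᵇ P (F a) ≡ filterᵇ P (G a)) → filterᵇ P (concatMap F xs) ≡ filterᵇ P (concatMap G xs)
filterᵇ-concatMap-cong P F G [] h = refl
filterᵇ-concatMap-cong P F G (x ∷ xs) h = begin
  filterᵇ P (F x ++ concatMap F xs)              ≡⟨ filterᵇ-++ P (F x) (concatMap F xs) ⟩
  filterᵇ P (F x) ++ filterᵇ P (concatMap F xs)  ≡⟨ cong₂ _++_ (h x) (filterᵇ-concatMap-cong P F G xs h) ⟩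
  filterᵇ P (G x) ++ filterᵇ P (concatMap G xs)  ≡⟨ filterᵇ-++ P (G x) (concatMap G xs) ⟨
  filterᵇ P (G x ++ concatMap G xs)              ∎
  where open ≡-Reasoning

==ᶜ-sound : ∀ p q → (p ==ᶜ q) ≡ true → p ≡ q
==ᶜ-sound (a , b) (c , d) e with a ℤ.≟ c | b ℤ.≟ d
... | yes refl | yes refl = refl
... | yes _ | no _ = ⊥-elim (true≢false (sym e))
... | no _ | _ = ⊥-elim (true≢false (sym e))

==ᶜ-refl : ∀ p → (p ==ᶜ p) ≡ true
==ᶜ-refl (a , b) with a ℤ.≟ a | b ℤ.≟ b
... | yes _ | yes _ = refl
... | no a≢a | _ = ⊥-elim (a≢a refl)
... | yes _ | no b≢b = ⊥-elim (b≢b refl)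

hstep vstep : Cell → Cell
hstep (a , b) = (a ℤ.+ ℤ.1ℤ , b)
vstep (a , b) = (a , b ℤ.+ ℤ.1ℤ)

+1-injective : ∀ i j → i ℤ.+ ℤ.1ℤ ≡ j ℤ.+ ℤ.1ℤ → i ≡ j
+1-injective i j e = trans (sym (minus-one i)) (trans (cong (ℤ._+ ℤ.-1ℤ) e) (minus-one j))
  where
  minus-one : ∀ i → (i ℤ.+ ℤ.1ℤ) ℤ.+ ℤ.-1ℤ ≡ i
  minus-one i = trans (ℤP.+-assoc i ℤ.1ℤ ℤ.-1ℤ) (ℤP.+-identityʳ i)

hstep-injective : ∀ p q → hstep p ≡ hstep q → p ≡ q
hstep-injective (a , b) (c , d) e = cong₂ _,_ (+1-injective a c (cong proj₁ e)) (cong proj₂ e)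

vstep-injective : ∀ p q → vstep p ≡ vstep q → p ≡ q
vstep-injective (a , b) (c , d) e = cong₂ _,_ (cong proj₁ e) (+1-injective b d (cong proj₂ e))

∈ᵇ-complete : ∀ q Y → q ∈ Y → q ∈ᵇ Y ≡ true
∈ᵇ-complete q (y ∷ Y) (here refl) rewrite ==ᶜ-refl q = refl
∈ᵇ-complete q (y ∷ Y) (there m) with q ==ᶜ y
... | true = refl
... | false = ∈ᵇ-complete q Y m

∈ᵇ-filterᵇ : ∀ g q Y → (q ∈ᵇ filterᵇ g Y) ≡ (g q ∧ (q ∈ᵇ Y))
∈ᵇ-filterᵇ g q [] with g q
... | true = refl
... | false = refl
∈ᵇ-filterᵇ g q (y ∷ Y) with g y in gy
... | true = kept (q ==ᶜ y) (λ e → trans (cong g (==ᶜ-sound q y e)) gy)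
  where
  kept : ∀ b → (b ≡ true → g q ≡ true) → b ∨ (q ∈ᵇ filterᵇ g Y) ≡ g q ∧ (b ∨ (q ∈ᵇ Y))
  kept true h rewrite h refl = refl
  kept false h = ∈ᵇ-filterᵇ g q Y
... | false = dropped (q ==ᶜ y) (λ e → trans (cong g (==ᶜ-sound q y e)) gy)
  where
  dropped : ∀ b → (b ≡ true → g q ≡ false) → (q ∈ᵇ filterᵇ g Y) ≡ g q ∧ (b ∨ (q ∈ᵇ Y))
  dropped true h rewrite h refl | ∈ᵇ-filterᵇ g q Y | h refl = refl
  dropped false h = ∈ᵇ-filterᵇ g q Y

covers-cases : ∀ x u v → covers x (u , v) ≡ true → x ≡ u ⊎ x ≡ v
covers-cases x u v e with x ==ᶜ u in k
... | true = inj₁ (==ᶜ-sound x u k)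
... | false = inj₂ (==ᶜ-sound x v e)

covers-first : ∀ u v → covers u (u , v) ≡ true
covers-first u v rewrite ==ᶜ-refl u = refl

covers-second : ∀ u v → covers v (u , v) ≡ true
covers-second u v rewrite ==ᶜ-refl v with v ==ᶜ u
... | true = refl
... | false = refl

countSub : (List Domino → Bool) → List Domino → ℕ
countSub P L = length (filterᵇ P (subsets L))

countSub-∷ : ∀ P x L → countSub P (x ∷ L) ≡ countSub P L + countSub (λ D → P (x ∷ D)) L
countSub-∷ P x L = begin
  length (filterᵇ P (subsets L ++ map (x ∷_) (subsets L)))
    ≡⟨ cong length (filterᵇ-++ P (subsets L) _) ⟩
  length (filterᵇ P (subsets L) ++ filterᵇ P (map (x ∷_) (subsets L)))
    ≡⟨ LP.length-++ (filterᵇ P (subsets L)) ⟩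
  countSub P L + length (filterᵇ P (map (x ∷_) (subsets L)))
    ≡⟨ cong (λ z → countSub P L + length z) (filterᵇ-map P (x ∷_) (subsets L)) ⟩
  countSub P L + length (map (x ∷_) (filterᵇ (λ D → P (x ∷ D)) (subsets L)))
    ≡⟨ cong (λ n → countSub P L + n) (LP.length-map (x ∷_) (filterᵇ (λ D → P (x ∷ D)) (subsets L))) ⟩
  countSub P L + countSub (λ D → P (x ∷ D)) L ∎
  where open ≡-Reasoning

countSub-zero : ∀ (R : Domino → Set) (P : List Domino → Bool) L →
  (∀ D → All R D → P D ≡ false) → All R L → countSub P L ≡ 0
countSub-zero R P [] h [] with P [] | h [] []
... | false | refl = refl
countSub-zero R P (x ∷ L) h (rx ∷ rL) =
  trans (countSub-∷ P x L)
    (cong₂ _+_ (countSub-zero R P L h rL)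
               (countSub-zero R (λ D → P (x ∷ D)) L (λ D rD → h (x ∷ D) (rx ∷ rD)) rL))

countSub-cong : ∀ P Q L → (∀ D → P D ≡ Q D) → countSub P L ≡ countSub Q L
countSub-cong P Q L h = cong length (filterᵇ-cong P Q (subsets L) h)

countSub-[] : ∀ P Q → P [] ≡ Q [] → countSub P [] ≡ countSub Q []
countSub-[] P Q e with P [] | Q []
... | true | true = refl
... | false | false = refl
... | true | false = ⊥-elim (true≢false e)
... | false | true = ⊥-elim (true≢false (sym e))

countSub-pass : ∀ (G H : List Domino → Bool) x L L' A →
  countSub (λ D → G (A ++ D)) L ≡ countSub (λ D → H (A ++ D)) L' →
  countSub (λ D → G ((A ++ x ∷ []) ++ D)) L ≡ countSub (λ D → H ((A ++ x ∷ []) ++ D)) L' →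
  countSub (λ D → G (A ++ D)) (x ∷ L) ≡ countSub (λ D → H (A ++ D)) (x ∷ L')
countSub-pass G H x L L' A skip take = begin
  countSub (λ D → G (A ++ D)) (x ∷ L)
    ≡⟨ countSub-∷ _ x L ⟩
  countSub (λ D → G (A ++ D)) L + countSub (λ D → G (A ++ x ∷ D)) L
    ≡⟨ cong₂ _+_ skip (trans (reassociate G L) (trans take (sym (reassociate H L')))) ⟩
  countSub (λ D → H (A ++ D)) L' + countSub (λ D → H (A ++ x ∷ D)) L'
    ≡⟨ countSub-∷ _ x L' ⟨
  countSub (λ D → H (A ++ D)) (x ∷ L') ∎
  where
  open ≡-Reasoning
  reassociate : ∀ K M → countSub (λ D → K (A ++ x ∷ D)) M ≡ countSub (λ D → K ((A ++ x ∷ []) ++ D)) M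
  reassociate K M = countSub-cong _ _ M (λ D → cong K (sym (LP.++-assoc A (x ∷ []) D)))

coverCount : Cell → List Domino → ℕ
coverCount p D = length (filterᵇ (covers p) D)

coverCount-++ : ∀ p A B → coverCount p (A ++ B) ≡ coverCount p A + coverCount p B
coverCount-++ p A B = trans (cong length (filterᵇ-++ (covers p) A B)) (LP.length-++ (filterᵇ (covers p) A))

indicator : Bool → ℕ
indicator true = 1
indicator false = 0

coverCount-∷ : ∀ p x E → coverCount p (x ∷ E) ≡ indicator (covers p x) + coverCount p E
coverCount-∷ p x E with covers p x
... | true = refl
... | false = refl

coverCount-zero : ∀ p D → All (λ e → covers p e ≡ false) D → coverCount p D ≡ 0
coverCount-zero p [] [] = refl
coverCount-zero p (e ∷ D) (h ∷ hs) rewrite h = coverCount-zero p D hs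

coverCount-∷-≤ : ∀ p x E → coverCount p E ≤ coverCount p (x ∷ E)
coverCount-∷-≤ p x E with covers p x
... | true = ℕP.n≤1+n _
... | false = ℕP.≤-refl

all-cong : ∀ (f g : Cell → Bool) Y → (∀ p → f p ≡ g p) → all f Y ≡ all g Y
all-cong f g [] h = refl
all-cong f g (y ∷ Y) h = cong₂ _∧_ (h y) (all-cong f g Y h)

all-false : ∀ (f : Cell → Bool) {x} Y → x ∈ Y → f x ≡ false → all f Y ≡ false
all-false f (y ∷ Y) (here refl) e rewrite e = refl
all-false f (y ∷ Y) (there m) e with f y
... | true = all-false f Y m e
... | false = refl

≥2⇒≢ᵇ1 : ∀ n → 2 ≤ n → (n ≡ᵇ 1) ≡ false
≥2⇒≢ᵇ1 (suc (suc n)) (s≤s (s≤s _)) = refl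

∈-tail : ∀ {A : Set} {w x : A} {L} → w ∈ x ∷ L → (w ≡ x → ⊥) → w ∈ L
∈-tail (here e) ne = ⊥-elim (ne e)
∈-tail (there m) ne = m

-- If every domino of X covering c is w, then every
-- tiling of X contains w, and removing it gives a bijection with the tilings of
-- X ∖ w; hence T X = T (X ∖ w).
module ForcedDomino (X : Region) (w : Domino) (c c' : Cell)
  (covers-w : ∀ x → covers x w ≡ true → x ≡ c ⊎ x ≡ c')
  (w-covers-c : covers c w ≡ true) (w-covers-c' : covers c' w ≡ true)
  (c∈X : c ∈ X) (c'∈X : c' ∈ X) where

  meets : Domino → Bool
  meets e = covers (proj₁ e) w ∨ covers (proj₂ e) w

  Disjoint : Domino → Set
  Disjoint e = meets e ≡ false

  Forces : Domino → Set
  Forces e = covers c e ≡ true → e ≡ w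

  X∖w : Region
  X∖w = filterᵇ (λ p → not (covers p w)) X

  dropMeeting : List Domino → List Domino
  dropMeeting = filterᵇ (λ e → not (meets e))

  cell-of-w : ∀ x q → x ≡ c ⊎ x ≡ c' → (x ==ᶜ q) ≡ true → covers q w ≡ true
  cell-of-w x q (inj₁ refl) e rewrite ==ᶜ-sound x q e = w-covers-c
  cell-of-w x q (inj₂ refl) e rewrite ==ᶜ-sound x q e = w-covers-c'

  disjoint-misses : ∀ x → x ≡ c ⊎ x ≡ c' → ∀ e → Disjoint e → covers x e ≡ false
  disjoint-misses x h (e₁ , e₂) nt with x ==ᶜ e₁ in eq₁ | x ==ᶜ e₂ in eq₂
  ... | false | false = refl
  ... | true | _ rewrite cell-of-w x e₁ h eq₁ = ⊥-elim (true≢false nt)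
  ... | false | true rewrite cell-of-w x e₂ h eq₂ with covers e₁ w
  ...   | true = ⊥-elim (true≢false nt)
  ...   | false = ⊥-elim (true≢false nt)

  meets-at-partner : ∀ e → meets e ≡ true → covers c e ≡ false → covers c' e ≡ true
  meets-at-partner (e₁ , e₂) m ncc with ∨-true {covers e₁ w} m
  ... | inj₁ k with covers-w e₁ k
  ...   | inj₂ refl rewrite ==ᶜ-refl c' = refl
  ...   | inj₁ refl rewrite ==ᶜ-refl c = ⊥-elim (true≢false ncc)
  meets-at-partner (e₁ , e₂) m ncc | inj₂ k with covers-w e₂ k
  ...   | inj₂ refl rewrite ==ᶜ-refl c' with c' ==ᶜ e₁
  ...     | true = refl
  ...     | false = refl
  meets-at-partner (e₁ , e₂) m ncc | inj₂ k | inj₁ refl rewrite ==ᶜ-refl c with c ==ᶜ e₁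
  ...     | true = ⊥-elim (true≢false ncc)
  ...     | false = ⊥-elim (true≢false ncc)

  meets-w : meets w ≡ true
  meets-w rewrite ==ᶜ-refl (proj₁ w) = refl

  tiling-with-w : ∀ E → All Disjoint E → isTiling X (w ∷ E) ≡ isTiling X∖w E
  tiling-with-w E nt = go X
    where
    go : ∀ Y → all (λ p → coverCount p (w ∷ E) ≡ᵇ 1) Y
             ≡ all (λ p → coverCount p E ≡ᵇ 1) (filterᵇ (λ p → not (covers p w)) Y)
    go [] = refl
    go (y ∷ Y) with covers y w in k
    ... | true rewrite coverCount-zero y E (All.map (λ {e} → disjoint-misses y (covers-w y k) e) nt) = go Y
    ... | false = cong ((coverCount y E ≡ᵇ 1) ∧_) (go Y)

  isTiling-move-w : ∀ A D → isTiling X (A ++ w ∷ D) ≡ isTiling X (w ∷ A ++ D)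
  isTiling-move-w A D = all-cong _ _ X (λ p → cong (_≡ᵇ 1) (count p))
    where
    count : ∀ p → coverCount p (A ++ w ∷ D) ≡ coverCount p (w ∷ A ++ D)
    count p = begin
      coverCount p (A ++ w ∷ D)                        ≡⟨ coverCount-++ p A (w ∷ D) ⟩
      coverCount p A + coverCount p (w ∷ D)            ≡⟨ cong (λ n → coverCount p A + n) (coverCount-∷ p w D) ⟩
      coverCount p A + (indicator (covers p w) + coverCount p D)
        ≡⟨ x∙yz≈y∙xz (coverCount p A) (indicator (covers p w)) (coverCount p D) ⟩
      indicator (covers p w) + (coverCount p A + coverCount p D)
        ≡⟨ cong (λ n → indicator (covers p w) + n) (coverCount-++ p A D) ⟨
      indicator (covers p w) + coverCount p (A ++ D)   ≡⟨ coverCount-∷ p w (A ++ D) ⟨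
      coverCount p (w ∷ A ++ D)                        ∎
      where open ≡-Reasoning

  c-count≤c'-count : ∀ D → All Forces D → coverCount c D ≤ coverCount c' D
  c-count≤c'-count [] [] = z≤n
  c-count≤c'-count (e ∷ D) (r ∷ rs) with covers c e in k
  ... | true with r refl
  ...   | refl rewrite w-covers-c' = s≤s (c-count≤c'-count D rs)
  c-count≤c'-count (e ∷ D) (r ∷ rs) | false =
    ℕP.≤-trans (c-count≤c'-count D rs) (coverCount-∷-≤ c' e D)

  c-uncovered : ∀ E → All (λ e → covers c e ≡ false) E → isTiling X E ≡ false
  c-uncovered E h = all-false _ X c∈X (cong (_≡ᵇ 1) (coverCount-zero c E h))

  -- x covers c' but not c, and every later domino obeys 'Forces': if c is
  -- covered once, then c' is covered twice.
  c'-covered-without-w : ∀ A x D → All Disjoint A → covers c x ≡ false → covers c' x ≡ true → All Forces D →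
    isTiling X (A ++ x ∷ D) ≡ false
  c'-covered-without-w A x D nta ncx c'x rD with coverCount c (A ++ x ∷ D) ≡ᵇ 1 in k
  ... | false = all-false _ X c∈X k
  ... | true = all-false _ X c'∈X (≥2⇒≢ᵇ1 _ twice)
    where
    open ℕP.≤-Reasoning
    once : coverCount c (A ++ x ∷ D) ≡ 1
    once = ℕP.≡ᵇ⇒≡ _ 1 (subst True (sym k) _)
    only-in-D : coverCount c (A ++ x ∷ D) ≡ coverCount c D
    only-in-D = begin-equality
      coverCount c (A ++ x ∷ D)          ≡⟨ coverCount-++ c A (x ∷ D) ⟩
      coverCount c A + coverCount c (x ∷ D)
        ≡⟨ cong₂ _+_ (coverCount-zero c A (All.map (λ {e} → disjoint-misses c (inj₁ refl) e) nta))
                     (coverCount-∷ c x D) ⟩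
      indicator (covers c x) + coverCount c D ≡⟨ cong (λ b → indicator b + coverCount c D) ncx ⟩
      coverCount c D                     ∎
    twice : 2 ≤ coverCount c' (A ++ x ∷ D)
    twice = begin
      2                                  ≡⟨ cong suc (sym (trans (sym only-in-D) once)) ⟩
      suc (coverCount c D)               ≤⟨ s≤s (c-count≤c'-count D rD) ⟩
      suc (coverCount c' D)              ≡⟨ trans (coverCount-∷ c' x D) (cong (λ b → indicator b + coverCount c' D) c'x) ⟨
      coverCount c' (x ∷ D)              ≤⟨ ℕP.m≤n+m _ (coverCount c' A) ⟩
      coverCount c' A + coverCount c' (x ∷ D) ≡⟨ coverCount-++ c' A (x ∷ D) ⟨
      coverCount c' (A ++ x ∷ D)         ∎

  c'-covered-twice : ∀ A x D → covers c' x ≡ true → isTiling X (w ∷ A ++ x ∷ D) ≡ false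
  c'-covered-twice A x D c'x = all-false _ X c'∈X (≥2⇒≢ᵇ1 _ twice)
    where
    open ℕP.≤-Reasoning
    twice : 2 ≤ coverCount c' (w ∷ A ++ x ∷ D)
    twice = begin
      2                                  ≡⟨ cong (λ b → suc (indicator b)) c'x ⟨
      suc (indicator (covers c' x))      ≤⟨ s≤s (ℕP.m≤m+n _ (coverCount c' D)) ⟩
      suc (indicator (covers c' x) + coverCount c' D) ≡⟨ cong suc (coverCount-∷ c' x D) ⟨
      suc (coverCount c' (x ∷ D))        ≤⟨ s≤s (ℕP.m≤n+m _ (coverCount c' A)) ⟩
      suc (coverCount c' A + coverCount c' (x ∷ D)) ≡⟨ cong suc (coverCount-++ c' A (x ∷ D)) ⟨
      suc (coverCount c' (A ++ x ∷ D))
        ≡⟨ trans (coverCount-∷ c' w (A ++ x ∷ D)) (cong (λ b → indicator b + coverCount c' (A ++ x ∷ D)) w-covers-c') ⟨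
      coverCount c' (w ∷ A ++ x ∷ D)     ∎

  count-after-w : ∀ L A → w ∉ L → All Forces L → All Disjoint A →
    countSub (λ D → isTiling X (w ∷ A ++ D)) L ≡ countSub (λ D → isTiling X∖w (A ++ D)) (dropMeeting L)
  count-after-w [] A w∉ rL nta = countSub-[] (λ D → isTiling X (w ∷ A ++ D)) (λ D → isTiling X∖w (A ++ D)) (begin
    isTiling X (w ∷ A ++ [])  ≡⟨ cong (λ E → isTiling X (w ∷ E)) (LP.++-identityʳ A) ⟩
    isTiling X (w ∷ A)        ≡⟨ tiling-with-w A nta ⟩
    isTiling X∖w A            ≡⟨ cong (isTiling X∖w) (LP.++-identityʳ A) ⟨
    isTiling X∖w (A ++ [])    ∎)
    where open ≡-Reasoning
  count-after-w (x ∷ L) A w∉ (rx ∷ rL) nta with meets x in mx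
  ... | true = begin
    countSub (λ D → isTiling X (w ∷ A ++ D)) (x ∷ L)   ≡⟨ countSub-∷ _ x L ⟩
    countSub (λ D → isTiling X (w ∷ A ++ D)) L + countSub (λ D → isTiling X (w ∷ A ++ x ∷ D)) L
      ≡⟨ cong₂ _+_ (count-after-w L A (w∉ ∘ there) rL nta)
                   (countSub-zero (λ _ → ⊤) _ L (λ D _ → c'-covered-twice A x D c'x) (All.universal (λ _ → tt) L)) ⟩
    countSub (λ D → isTiling X∖w (A ++ D)) (dropMeeting L) + 0 ≡⟨ ℕP.+-identityʳ _ ⟩
    countSub (λ D → isTiling X∖w (A ++ D)) (dropMeeting L) ∎
    where
    open ≡-Reasoning
    ncx : covers c x ≡ false
    ncx = ≢true⇒false _ (λ cx → w∉ (here (sym (rx cx))))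
    c'x : covers c' x ≡ true
    c'x = meets-at-partner x mx ncx
  ... | false = countSub-pass (λ E → isTiling X (w ∷ E)) (isTiling X∖w) x L (dropMeeting L) A
    (count-after-w L A (w∉ ∘ there) rL nta)
    (count-after-w L (A ++ x ∷ []) (w∉ ∘ there) rL (AllP.++⁺ nta (mx ∷ [])))

  -- Before w is reached, dominoes disjoint from w are passed through; a domino
  -- meeting w at c' alone contributes nothing, and at w itself the choice is
  -- forced since c must be covered.
  count-before-w : ∀ L A → Unique L → w ∈ L → All Forces L → All Disjoint A →
    countSub (λ D → isTiling X (A ++ D)) L ≡ countSub (λ D → isTiling X∖w (A ++ D)) (dropMeeting L)
  count-before-w (x ∷ L) A (x∉ ∷ uL) w∈ (rx ∷ rL) nta with meets x in mx
  ... | false = countSub-pass (isTiling X) (isTiling X∖w) x L (dropMeeting L) A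
    (count-before-w L A uL w∈L rL nta)
    (count-before-w L (A ++ x ∷ []) uL w∈L rL (AllP.++⁺ nta (mx ∷ [])))
    where
    w∈L : w ∈ L
    w∈L = ∈-tail w∈ (λ e → true≢false (trans (sym meets-w) (trans (cong meets e) mx)))
  ... | true with covers c x in cx
  ...   | true with rx refl
  ...     | refl = trans (countSub-∷ _ w L) (cong₂ _+_
      (countSub-zero (λ e → covers c e ≡ false) _ L
        (λ D h → c-uncovered (A ++ D) (AllP.++⁺ (All.map (λ {e} → disjoint-misses c (inj₁ refl) e) nta) h)) c∉L)
      (trans (countSub-cong _ _ L (isTiling-move-w A)) (count-after-w L A w∉L rL nta)))
    where
    w∉L : w ∉ L
    w∉L m = All.lookup x∉ m refl
    c∉L : All (λ e → covers c e ≡ false) L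
    c∉L = All.tabulate (λ {e} m → ≢true⇒false _ (λ ce → w∉L (subst (_∈ L) (All.lookup rL m ce) m)))
  count-before-w (x ∷ L) A (x∉ ∷ uL) w∈ (rx ∷ rL) nta | true | false =
    trans (countSub-∷ _ x L) (trans (cong₂ _+_ (count-before-w L A uL w∈L rL nta)
      (countSub-zero Forces _ L (λ D rD → c'-covered-without-w A x D nta cx (meets-at-partner x mx cx) rD) rL))
      (ℕP.+-identityʳ _))
    where
    w∈L : w ∈ L
    w∈L = ∈-tail w∈ (λ e → true≢false (trans (sym w-covers-c) (trans (cong (covers c) e) cx)))

  forced-domino : Unique (dominoesIn X) → w ∈ dominoesIn X → All Forces (dominoesIn X) →
    dominoesIn X∖w ≡ dropMeeting (dominoesIn X) → T X ≡ T X∖w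
  forced-domino u w∈ forces eq = trans (count-before-w (dominoesIn X) [] u w∈ forces [])
    (cong (countSub (isTiling X∖w)) (sym eq))

dominoesAt : Region → Cell → List Domino
dominoesAt X (a , b) =
    (if ((a ℤ.+ ℤ.1ℤ) , b) ∈ᵇ X then ((a , b) , ((a ℤ.+ ℤ.1ℤ) , b)) ∷ [] else [])
    ++ (if (a , (b ℤ.+ ℤ.1ℤ)) ∈ᵇ X then ((a , b) , (a , (b ℤ.+ ℤ.1ℤ))) ∷ [] else [])

module RestrictDominoes (g : Cell → Bool) (X : Region) where

  bothCells : Domino → Bool
  bothCells e = g (proj₁ e) ∧ g (proj₂ e)

  private
    if-both : ∀ x y b → y ≡ true → x ∧ b ≡ b ∧ (y ∧ x)
    if-both x y b refl with x | b
    ... | true | true = refl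
    ... | true | false = refl
    ... | false | true = refl
    ... | false | false = refl

    if-none : ∀ b x y → y ≡ false → b ∧ (y ∧ x) ≡ false
    if-none false x y e = refl
    if-none true x y refl = refl

  dominoesAt-kept : ∀ p → g p ≡ true → dominoesAt (filterᵇ g X) p ≡ filterᵇ bothCells (dominoesAt X p)
  dominoesAt-kept (a , b) gp = sym (trans (filterᵇ-++ bothCells (if (h ∈ᵇ X) then eh ∷ [] else []) _)
    (cong₂ _++_
      (trans (filterᵇ-if bothCells (h ∈ᵇ X) eh)
        (cong (λ z → if z then eh ∷ [] else []) (sym (trans (∈ᵇ-filterᵇ g h X) (if-both (g h) (g (a , b)) (h ∈ᵇ X) gp)))))
      (trans (filterᵇ-if bothCells (v ∈ᵇ X) ev)
        (cong (λ z → if z then ev ∷ [] else []) (sym (trans (∈ᵇ-filterᵇ g v X) (if-both (g v) (g (a , b)) (v ∈ᵇ X) gp)))))))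
    where
    h v : Cell
    h = hstep (a , b)
    v = vstep (a , b)
    eh ev : Domino
    eh = ((a , b) , h)
    ev = ((a , b) , v)

  dominoesAt-dropped : ∀ p → g p ≡ false → filterᵇ bothCells (dominoesAt X p) ≡ []
  dominoesAt-dropped (a , b) gp = trans (filterᵇ-++ bothCells (if (h ∈ᵇ X) then eh ∷ [] else []) _)
    (cong₂ _++_
      (trans (filterᵇ-if bothCells (h ∈ᵇ X) eh) (cong (λ z → if z then eh ∷ [] else []) (if-none (h ∈ᵇ X) (g h) (g (a , b)) gp)))
      (trans (filterᵇ-if bothCells (v ∈ᵇ X) ev) (cong (λ z → if z then ev ∷ [] else []) (if-none (v ∈ᵇ X) (g v) (g (a , b)) gp))))
    where
    h v : Cell
    h = hstep (a , b)
    v = vstep (a , b)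
    eh ev : Domino
    eh = ((a , b) , h)
    ev = ((a , b) , v)

  dominoesIn-filterᵇ : dominoesIn (filterᵇ g X) ≡ filterᵇ bothCells (dominoesIn X)
  dominoesIn-filterᵇ = go X
    where
    go : ∀ Y → concatMap (dominoesAt (filterᵇ g X)) (filterᵇ g Y) ≡ filterᵇ bothCells (concatMap (dominoesAt X) Y)
    go [] = refl
    go (y ∷ Y) with g y in gy
    ... | true = trans (cong₂ _++_ (dominoesAt-kept y gy) (go Y)) (sym (filterᵇ-++ bothCells (dominoesAt X y) _))
    ... | false = trans (go Y) (sym (trans (filterᵇ-++ bothCells (dominoesAt X y) _) (cong (_++ _) (dominoesAt-dropped y gy))))

dominoesAt-shape : ∀ X p e → e ∈ dominoesAt X p →
  proj₁ e ≡ p × ((proj₂ e ≡ hstep p ⊎ proj₂ e ≡ vstep p) × proj₂ e ∈ᵇ X ≡ true)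
dominoesAt-shape X (a , b) e m with (a ℤ.+ ℤ.1ℤ , b) ∈ᵇ X in k1 | (a , b ℤ.+ ℤ.1ℤ) ∈ᵇ X in k2
dominoesAt-shape X (a , b) e (here refl) | true | _ = refl , inj₁ refl , k1
dominoesAt-shape X (a , b) e (there (here refl)) | true | true = refl , inj₂ refl , k2
dominoesAt-shape X (a , b) e (here refl) | false | true = refl , inj₂ refl , k2

dominoes-shape : ∀ X Y e → e ∈ concatMap (dominoesAt X) Y →
  proj₁ e ∈ Y × ((proj₂ e ≡ hstep (proj₁ e) ⊎ proj₂ e ≡ vstep (proj₁ e)) × proj₂ e ∈ᵇ X ≡ true)
dominoes-shape X (y ∷ Y) e m with MP.∈-++⁻ (dominoesAt X y) m
... | inj₁ m₁ with dominoesAt-shape X y e m₁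
...   | refl , r = here refl , r
dominoes-shape X (y ∷ Y) e m | inj₂ m₂ with dominoes-shape X Y e m₂
... | a , r = there a , r

horizontal∈dominoes : ∀ X p → p ∈ X → hstep p ∈ X → (p , hstep p) ∈ dominoesIn X
horizontal∈dominoes X p p∈ q∈ = go X p∈
  where
  at : ∀ p → hstep p ∈ᵇ X ≡ true → (p , hstep p) ∈ dominoesAt X p
  at (a , b) k rewrite k = here refl
  go : ∀ Y → p ∈ Y → (p , hstep p) ∈ concatMap (dominoesAt X) Y
  go (y ∷ Y) (here refl) = MP.∈-++⁺ˡ (at p (∈ᵇ-complete _ X q∈))
  go (y ∷ Y) (there m) = MP.∈-++⁺ʳ (dominoesAt X y) (go Y m)

vertical∈dominoes : ∀ X p → p ∈ X → vstep p ∈ X → (p , vstep p) ∈ dominoesIn X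
vertical∈dominoes X p p∈ q∈ = go X p∈
  where
  at : ∀ p → vstep p ∈ᵇ X ≡ true → (p , vstep p) ∈ dominoesAt X p
  at (a , b) k rewrite k with (a ℤ.+ ℤ.1ℤ , b) ∈ᵇ X
  ... | true = there (here refl)
  ... | false = here refl
  go : ∀ Y → p ∈ Y → (p , vstep p) ∈ concatMap (dominoesAt X) Y
  go (y ∷ Y) (here refl) = MP.∈-++⁺ˡ (at p (∈ᵇ-complete _ X q∈))
  go (y ∷ Y) (there m) = MP.∈-++⁺ʳ (dominoesAt X y) (go Y m)

dominoesIn-unique : ∀ X → Unique X → Unique (dominoesIn X)
dominoesIn-unique X = go X
  where
  at-unique : ∀ p → Unique (dominoesAt X p)
  at-unique (a , b) with (a ℤ.+ ℤ.1ℤ , b) ∈ᵇ X | (a , b ℤ.+ ℤ.1ℤ) ∈ᵇ X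
  ... | true | true = ((λ e → ℤP.i≢suc[i] (trans (cong (proj₂ ∘ proj₂) e) (ℤP.+-comm b ℤ.1ℤ))) ∷ []) ∷ [] ∷ []
  ... | true | false = [] ∷ []
  ... | false | true = [] ∷ []
  ... | false | false = []
  go : ∀ Y → Unique Y → Unique (concatMap (dominoesAt X) Y)
  go [] u = []
  go (y ∷ Y) (y∉ ∷ u) = UP.++⁺ (at-unique y) (go Y u) disjoint
    where
    disjoint : ∀ {v} → (v ∈ dominoesAt X y × v ∈ concatMap (dominoesAt X) Y → ⊥)
    disjoint {v} (m₁ , m₂) with dominoesAt-shape X y v m₁ | dominoes-shape X Y v m₂
    ... | refl , _ | m , _ = All.lookup y∉ m refl

data Dir : Set where
  H V : Dir

neighbour : Dir → Cell → Cell
neighbour H = hstep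
neighbour V = vstep

Slot : Region → Domino → Cell → Domino → Set
Slot X w q e = (q ∈ᵇ X ≡ false) ⊎ (e ≡ w)

partner : ∀ {c u v : Cell} → c ≡ u ⊎ c ≡ v → Cell
partner {v = v} (inj₁ _) = v
partner {u = u} (inj₂ _) = u

covers-cell-or-partner : ∀ {c u v : Cell} (h : c ≡ u ⊎ c ≡ v) x → covers x (u , v) ≡ true → x ≡ c ⊎ x ≡ partner h
covers-cell-or-partner {u = u} {v} h x k with covers-cases x u v k | h
... | inj₁ refl | inj₁ refl = inj₁ refl
... | inj₁ refl | inj₂ refl = inj₂ refl
... | inj₂ refl | inj₁ refl = inj₂ refl
... | inj₂ refl | inj₂ refl = inj₁ refl

covers-cell : ∀ {c u v : Cell} (h : c ≡ u ⊎ c ≡ v) → covers c (u , v) ≡ true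
covers-cell {u = u} {v} (inj₁ refl) = covers-first u v
covers-cell {u = u} {v} (inj₂ refl) = covers-second u v

covers-partner : ∀ {c u v : Cell} (h : c ≡ u ⊎ c ≡ v) → covers (partner h) (u , v) ≡ true
covers-partner {u = u} {v} (inj₁ refl) = covers-second u v
covers-partner {u = u} {v} (inj₂ refl) = covers-first u v

cell∈ : ∀ X {c u v : Cell} (h : c ≡ u ⊎ c ≡ v) → u ∈ X → v ∈ X → c ∈ X
cell∈ X (inj₁ refl) u∈ v∈ = u∈
cell∈ X (inj₂ refl) u∈ v∈ = v∈

partner∈ : ∀ X {c u v : Cell} (h : c ≡ u ⊎ c ≡ v) → u ∈ X → v ∈ X → partner h ∈ X
partner∈ X (inj₁ refl) u∈ v∈ = v∈
partner∈ X (inj₂ refl) u∈ v∈ = u∈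

domino∈ : ∀ X u d → u ∈ X → neighbour d u ∈ X → (u , neighbour d u) ∈ dominoesIn X
domino∈ X u H = horizontal∈dominoes X u
domino∈ X u V = vertical∈dominoes X u

not-∨ : ∀ a b → not (a ∨ b) ≡ not a ∧ not b
not-∨ true b = refl
not-∨ false b = refl

module ForcedByNeighbours (X : Region) (uX : Unique X) (u : Cell) (d : Dir)
  (u∈X : u ∈ X) (v∈X : neighbour d u ∈ X) (c : Cell) (c∈w : c ≡ u ⊎ c ≡ neighbour d u)
  (qL qR qU qD : Cell) (eL : hstep qL ≡ c) (eR : hstep c ≡ qR) (eU : vstep c ≡ qU) (eD : vstep qD ≡ c)
  (sL : Slot X (u , neighbour d u) qL (qL , c)) (sR : Slot X (u , neighbour d u) qR (c , qR))
  (sU : Slot X (u , neighbour d u) qU (c , qU)) (sD : Slot X (u , neighbour d u) qD (qD , c)) where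

  private
    w : Domino
    w = (u , neighbour d u)

  open ForcedDomino X w c (partner c∈w) (covers-cell-or-partner c∈w) (covers-cell c∈w) (covers-partner c∈w)
    (cell∈ X c∈w u∈X v∈X) (partner∈ X c∈w u∈X v∈X)

  slot-used : ∀ q e → Slot X w q e → q ∈ᵇ X ≡ true → e ≡ w
  slot-used q e (inj₁ q∉) q∈ = ⊥-elim (true≢false (trans (sym q∈) q∉))
  slot-used q e (inj₂ e≡w) q∈ = e≡w

  -- A domino of X covering c has c as lower-left cell (partner qR or qU) or as
  -- upper-right cell (partner qL or qD); in all four cases it is w.
  all-forced : All Forces (dominoesIn X)
  all-forced = All.tabulate (λ {e} m → forces e m)
    where
    forces : ∀ e → e ∈ dominoesIn X → Forces e
    forces (e₁ , e₂) m k with dominoes-shape X X (e₁ , e₂) m | covers-cases c e₁ e₂ k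
    ... | _ , inj₁ refl , k2 | inj₁ refl =
      trans (cong (c ,_) eR) (slot-used qR (c , qR) sR (subst (λ z → z ∈ᵇ X ≡ true) eR k2))
    ... | _ , inj₂ refl , k2 | inj₁ refl =
      trans (cong (c ,_) eU) (slot-used qU (c , qU) sU (subst (λ z → z ∈ᵇ X ≡ true) eU k2))
    ... | m₁ , inj₁ refl , _ | inj₂ e with hstep-injective e₁ qL (trans (sym e) (sym eL))
    ...   | refl = trans (cong (qL ,_) (sym e)) (slot-used qL (qL , c) sL (∈ᵇ-complete qL X m₁))
    forces (e₁ , e₂) m k | m₁ , inj₂ refl , _ | inj₂ e with vstep-injective e₁ qD (trans (sym e) (sym eD))
    ...   | refl = trans (cong (qD ,_) (sym e)) (slot-used qD (qD , c) sD (∈ᵇ-complete qD X m₁))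

  forced-by-neighbours : T X ≡ T (filterᵇ (λ p → not (covers p w)) X)
  forced-by-neighbours = forced-domino (dominoesIn-unique X uX) (domino∈ X u d u∈X v∈X) all-forced
    (trans (RestrictDominoes.dominoesIn-filterᵇ (λ p → not (covers p w)) X)
      (filterᵇ-cong _ _ (dominoesIn X) (λ e → sym (not-∨ (covers (proj₁ e) w) (covers (proj₂ e) w)))))

-- The folded coordinate |a+½| - ½: it identifies a and -1-a.
fold : ℤ → ℕ
fold (+ x) = x
fold -[1+ x ] = x

rangeEntry : ℕ → ℕ → ℤ
rangeEntry M i = + i ℤ.- + M

map-applyUpTo : ∀ {A B : Set} (f : A → B) (g : ℕ → A) n → map f (applyUpTo g n) ≡ applyUpTo (f ∘ g) n
map-applyUpTo f g zero = refl
map-applyUpTo f g (suc n) = cong (f (g 0) ∷_) (map-applyUpTo f (g ∘ suc) n)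

applyUpTo-cong : ∀ {A : Set} (f g : ℕ → A) n → (∀ i → f i ≡ g i) → applyUpTo f n ≡ applyUpTo g n
applyUpTo-cong f g zero h = refl
applyUpTo-cong f g (suc n) h = cong₂ _∷_ (h 0) (applyUpTo-cong (f ∘ suc) (g ∘ suc) n (h ∘ suc))

range-applyUpTo : ∀ M → range M ≡ applyUpTo (rangeEntry M) (2 * M)
range-applyUpTo M = map-applyUpTo (λ i → + i ℤ.- + M) (λ i → i) (2 * M)

range-suc : ∀ m → range (suc m) ≡ -[1+ m ] ∷ (range m ++ (+ m ∷ []))
range-suc m = begin
  range (suc m)                                ≡⟨ range-applyUpTo (suc m) ⟩
  applyUpTo (rangeEntry (suc m)) (2 * suc m)   ≡⟨ cong (applyUpTo (rangeEntry (suc m))) two-suc ⟩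
  applyUpTo (rangeEntry (suc m)) (suc (suc (2 * m)))
    ≡⟨ cong (rangeEntry (suc m) 0 ∷_) (LP.applyUpTo-∷ʳ (rangeEntry (suc m) ∘ suc) (2 * m)) ⟨
  rangeEntry (suc m) 0 ∷ (applyUpTo (rangeEntry (suc m) ∘ suc) (2 * m) ∷ʳ rangeEntry (suc m) (suc (2 * m)))
    ≡⟨ cong₂ (λ a b → -[1+ m ] ∷ (a ∷ʳ b)) (applyUpTo-cong _ _ (2 * m) shift) last ⟩
  -[1+ m ] ∷ (applyUpTo (rangeEntry m) (2 * m) ∷ʳ + m)
    ≡⟨ cong (λ z → -[1+ m ] ∷ (z ∷ʳ + m)) (range-applyUpTo m) ⟨
  -[1+ m ] ∷ (range m ++ (+ m ∷ []))           ∎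
  where
  open ≡-Reasoning
  two-suc : 2 * suc m ≡ suc (suc (2 * m))
  two-suc = cong suc (ℕP.+-suc m (m + 0))
  shift : ∀ i → rangeEntry (suc m) (suc i) ≡ rangeEntry m i
  shift i = begin
    + suc i ℤ.- + suc m  ≡⟨ ℤP.m-n≡m⊖n (suc i) (suc m) ⟩
    suc i ℤ.⊖ suc m      ≡⟨ ℤP.[1+m]⊖[1+n]≡m⊖n i m ⟩
    i ℤ.⊖ m              ≡⟨ ℤP.m-n≡m⊖n i m ⟨
    + i ℤ.- + m          ∎
  last : rangeEntry (suc m) (suc (2 * m)) ≡ + m
  last = begin
    rangeEntry (suc m) (suc (2 * m)) ≡⟨ trans (ℤP.m-n≡m⊖n (suc (2 * m)) (suc m)) (ℤP.[1+m]⊖[1+n]≡m⊖n (2 * m) m) ⟩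
    (2 * m) ℤ.⊖ m                    ≡⟨ ℤP.⊖-≥ (ℕP.m≤m+n m (m + 0)) ⟩
    + (2 * m ∸ m)                    ≡⟨ cong +_ (ℕP.m+n∸m≡n m (m + 0)) ⟩
    + (m + 0)                        ≡⟨ cong +_ (ℕP.+-identityʳ m) ⟩
    + m                              ∎

Box : ℕ → (Cell → Bool) → Set
Box m Q = ∀ p → Q p ≡ true → fold (proj₁ p) < m × fold (proj₂ p) < m

module ShrinkGrid (m : ℕ) (Q : Cell → Bool) (box : Box m Q) where

  outside-column : ∀ a b → m ≤ fold a → Q (a , b) ≡ false
  outside-column a b le = ≢true⇒false _ (λ e → ℕP.<⇒≱ (proj₁ (box (a , b) e)) le)

  outside-row : ∀ a b → m ≤ fold b → Q (a , b) ≡ false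
  outside-row a b le = ≢true⇒false _ (λ e → ℕP.<⇒≱ (proj₂ (box (a , b) e)) le)

  column : ∀ a → filterᵇ Q (map (a ,_) (range (suc m))) ≡ filterᵇ Q (map (a ,_) (range m))
  column a = begin
    filterᵇ Q (map (a ,_) (range (suc m)))
      ≡⟨ cong (λ z → filterᵇ Q (map (a ,_) z)) (range-suc m) ⟩
    filterᵇ Q ((a , -[1+ m ]) ∷ map (a ,_) (range m ++ (+ m ∷ [])))
      ≡⟨ filterᵇ-reject Q _ _ (outside-row a -[1+ m ] ℕP.≤-refl) ⟩
    filterᵇ Q (map (a ,_) (range m ++ (+ m ∷ [])))
      ≡⟨ cong (filterᵇ Q) (LP.map-++ (a ,_) (range m) (+ m ∷ [])) ⟩
    filterᵇ Q (map (a ,_) (range m) ++ ((a , + m) ∷ []))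
      ≡⟨ filterᵇ-++ Q (map (a ,_) (range m)) _ ⟩
    filterᵇ Q (map (a ,_) (range m)) ++ filterᵇ Q ((a , + m) ∷ [])
      ≡⟨ cong (filterᵇ Q (map (a ,_) (range m)) ++_) (filterᵇ-reject Q _ [] (outside-row a (+ m) ℕP.≤-refl)) ⟩
    filterᵇ Q (map (a ,_) (range m)) ++ []
      ≡⟨ LP.++-identityʳ _ ⟩
    filterᵇ Q (map (a ,_) (range m)) ∎
    where open ≡-Reasoning

  outer-column : ∀ a → m ≤ fold a → ∀ ys → filterᵇ Q (map (a ,_) ys) ≡ []
  outer-column a le ys = trans (filterᵇ-map Q (a ,_) ys) (cong (map (a ,_)) (filterᵇ-none _ ys (λ b → outside-column a b le)))

  shrink-grid : filterᵇ Q (grid (suc m)) ≡ filterᵇ Q (grid m)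
  shrink-grid = begin
    filterᵇ Q (concatMap F (range (suc m)))
      ≡⟨ cong (λ z → filterᵇ Q (concatMap F z)) (range-suc m) ⟩
    filterᵇ Q (F -[1+ m ] ++ concatMap F (range m ++ (+ m ∷ [])))
      ≡⟨ filterᵇ-++ Q (F -[1+ m ]) _ ⟩
    filterᵇ Q (F -[1+ m ]) ++ filterᵇ Q (concatMap F (range m ++ (+ m ∷ [])))
      ≡⟨ cong₂ _++_ (outer-column -[1+ m ] ℕP.≤-refl _) (cong (filterᵇ Q) (LP.concatMap-++ F (range m) (+ m ∷ []))) ⟩
    filterᵇ Q (concatMap F (range m) ++ concatMap F (+ m ∷ []))
      ≡⟨ filterᵇ-++ Q (concatMap F (range m)) _ ⟩
    filterᵇ Q (concatMap F (range m)) ++ filterᵇ Q (F (+ m) ++ [])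
      ≡⟨ cong (filterᵇ Q (concatMap F (range m)) ++_)
              (trans (cong (filterᵇ Q) (LP.++-identityʳ (F (+ m)))) (outer-column (+ m) ℕP.≤-refl _)) ⟩
    filterᵇ Q (concatMap F (range m)) ++ []
      ≡⟨ LP.++-identityʳ _ ⟩
    filterᵇ Q (concatMap F (range m))
      ≡⟨ filterᵇ-concatMap-cong Q F G (range m) column ⟩
    filterᵇ Q (concatMap G (range m)) ∎
    where
    open ≡-Reasoning
    F G : ℤ → List Cell
    F a = map (a ,_) (range (suc m))
    G a = map (a ,_) (range m)

shrink-grid-by-two : ∀ m Q → Box m Q → filterᵇ Q (grid (suc (suc m))) ≡ filterᵇ Q (grid m)
shrink-grid-by-two m Q box = trans (ShrinkGrid.shrink-grid (suc m) Q larger) (ShrinkGrid.shrink-grid m Q box)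
  where
  larger : Box (suc m) Q
  larger p e = ℕP.m≤n⇒m≤1+n (proj₁ (box p e)) , ℕP.m≤n⇒m≤1+n (proj₂ (box p e))

grid-cartesianProduct : ∀ (xs ys : List ℤ) → concatMap (λ a → map (a ,_) ys) xs ≡ cartesianProduct xs ys
grid-cartesianProduct [] ys = refl
grid-cartesianProduct (x ∷ xs) ys = cong (map (x ,_) ys ++_) (grid-cartesianProduct xs ys)

rangeEntry-injective : ∀ M {i j} → rangeEntry M i ≡ rangeEntry M j → i ≡ j
rangeEntry-injective M {i} {j} e = ℤP.+-injective (trans (sym (add-back i)) (trans (cong (ℤ._+ + M) e) (add-back j)))
  where
  add-back : ∀ i → rangeEntry M i ℤ.+ + M ≡ + i
  add-back i = trans (ℤP.+-assoc (+ i) (ℤ.- + M) (+ M))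
    (trans (cong (λ z → (+ i) ℤ.+ z) (ℤP.+-inverseˡ (+ M))) (ℤP.+-identityʳ (+ i)))

grid-unique : ∀ M → Unique (grid M)
grid-unique M = subst Unique (sym (grid-cartesianProduct (range M) (range M)))
  (UP.cartesianProduct⁺ range-unique range-unique)
  where
  range-unique : Unique (range M)
  range-unique = UP.map⁺ (rangeEntry-injective M) (UP.upTo⁺ (2 * M))

range-complete : ∀ M a → fold a < M → a ∈ range M
range-complete M (+ x) lt = subst (_∈ range M) eq (MP.∈-map⁺ (rangeEntry M) (MP.∈-upTo⁺ lt'))
  where
  lt' : M + x < 2 * M
  lt' = subst (M + x <_) (cong (λ z → M + z) (sym (ℕP.+-identityʳ M))) (ℕP.+-monoʳ-< M lt)
  eq : rangeEntry M (M + x) ≡ + x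
  eq = trans (ℤP.m-n≡m⊖n (M + x) M) (trans (ℤP.⊖-≥ (ℕP.m≤m+n M x)) (cong +_ (ℕP.m+n∸m≡n M x)))
range-complete M -[1+ x ] lt = subst (_∈ range M) eq (MP.∈-map⁺ (rangeEntry M) (MP.∈-upTo⁺ lt'))
  where
  lt' : M ∸ suc x < 2 * M
  lt' = ℕP.≤-<-trans (ℕP.m∸n≤m M (suc x))
    (subst (M <_) (cong (λ z → M + z) (sym (ℕP.+-identityʳ M))) (ℕP.m<m+n M (ℕP.≤-<-trans z≤n lt)))
  eq : rangeEntry M (M ∸ suc x) ≡ -[1+ x ]
  eq = trans (ℤP.m-n≡m⊖n (M ∸ suc x) M)
    (trans (ℤP.⊖-< (ℕP.∸-monoʳ-< {M} {suc x} {0} (s≤s z≤n) lt)) (cong (λ z → ℤ.- (+ z)) (ℕP.m∸[m∸n]≡n lt)))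

grid-complete : ∀ M a b → fold a < M → fold b < M → (a , b) ∈ grid M
grid-complete M a b la lb =
  MP.∈-concatMap⁺ (λ a' → map (a' ,_) (range M)) (in-column (range M) (range-complete M a la))
  where
  in-column : ∀ xs → a ∈ xs → Any (λ a' → (a , b) ∈ map (a' ,_) (range M)) xs
  in-column (x ∷ xs) (here refl) = here (MP.∈-map⁺ (a ,_) (range-complete M b lb))
  in-column (x ∷ xs) (there m) = there (in-column xs m)

region-unique : ∀ M Q → Unique (filterᵇ Q (grid M))
region-unique M Q = UP.filter⁺ _ (grid-unique M)

region-∈ : ∀ M Q a b → Q (a , b) ≡ true → fold a < M → fold b < M → (a , b) ∈ filterᵇ Q (grid M)
region-∈ M Q a b q la lb = MP.∈-filter⁺ _ (grid-complete M a b la lb) (subst True (sym q) _)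

region-∉ : ∀ M Q p → Q p ≡ false → p ∈ᵇ filterᵇ Q (grid M) ≡ false
region-∉ M Q p q rewrite ∈ᵇ-filterᵇ Q p (grid M) | q = refl

⌊T?⌋ : ∀ b → ⌊ T? b ⌋ ≡ b
⌊T?⌋ true = refl
⌊T?⌋ false = refl

≤ᶻ-pos : ∀ m n → ⌊ (+ m) ℤ.≤? (+ n) ⌋ ≡ (m ≤ᵇ n)
≤ᶻ-pos m n = trans (⌊⌋-map′ _ _ (m ℕP.≤? n)) (trans (⌊⌋-map′ _ _ (T? (m ≤ᵇ n))) (⌊T?⌋ _))

≤ᶻ-neg : ∀ m n → ⌊ -[1+ m ] ℤ.≤? -[1+ n ] ⌋ ≡ (n ≤ᵇ m)
≤ᶻ-neg m n = trans (⌊⌋-map′ _ _ (n ℕP.≤? m)) (trans (⌊⌋-map′ _ _ (T? (n ≤ᵇ m))) (⌊T?⌋ _))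

-- x rounded up to an even number; the quartering lines are y = evenCeil x.
evenCeil : ℕ → ℕ
evenCeil zero = zero
evenCeil (suc zero) = 2
evenCeil (suc (suc x)) = suc (suc (evenCeil x))

evenCeil-spec : ∀ x → 2 * (suc x / 2) ≡ evenCeil x
evenCeil-spec zero = refl
evenCeil-spec (suc zero) = refl
evenCeil-spec (suc (suc x)) = begin
  2 * (suc (suc (suc x)) / 2)  ≡⟨ cong (2 *_) (DM.m/n≡1+[m∸n]/n {suc (suc (suc x))} {2} (s≤s (s≤s z≤n))) ⟩
  2 * (1 + suc x / 2)          ≡⟨ ℕP.*-distribˡ-+ 2 1 (suc x / 2) ⟩
  2 + 2 * (suc x / 2)          ≡⟨ cong (λ n → 2 + n) (evenCeil-spec x) ⟩
  2 + evenCeil x               ∎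
  where open ≡-Reasoning

evenCeil-≥ : ∀ x → x ≤ evenCeil x
evenCeil-≥ zero = z≤n
evenCeil-≥ (suc zero) = s≤s z≤n
evenCeil-≥ (suc (suc x)) = s≤s (s≤s (evenCeil-≥ x))

evenCeil-≤ : ∀ x → evenCeil x ≤ suc x
evenCeil-≤ zero = z≤n
evenCeil-≤ (suc zero) = ℕP.≤-refl
evenCeil-≤ (suc (suc x)) = s≤s (s≤s (evenCeil-≤ x))

evenCeil-mono : ∀ {x y} → x ≤ y → evenCeil x ≤ evenCeil y
evenCeil-mono {x} {y} le with ℕP.m≤n⇒∃[o]m+o≡n le
... | o , refl = go x o
  where
  step : ∀ x → evenCeil x ≤ evenCeil (suc x)
  step zero = z≤n
  step (suc zero) = ℕP.≤-refl
  step (suc (suc x)) = s≤s (s≤s (step x))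
  go : ∀ x o → evenCeil x ≤ evenCeil (x + o)
  go x zero = ℕP.≤-reflexive (cong evenCeil (sym (ℕP.+-identityʳ x)))
  go x (suc o) = ℕP.≤-trans (go x o) (subst (λ z → evenCeil (x + o) ≤ evenCeil z) (sym (ℕP.+-suc x o)) (step (x + o)))

evenCeil-even : ∀ n → evenCeil (n + n) ≡ n + n
evenCeil-even zero = refl
evenCeil-even (suc n) rewrite ℕP.+-suc n n = cong (λ z → suc (suc z)) (evenCeil-even n)

evenCeil-odd : ∀ n → evenCeil (suc (n + n)) ≡ suc (suc (n + n))
evenCeil-odd zero = refl
evenCeil-odd (suc n) rewrite ℕP.+-suc n n = cong (λ z → suc (suc z)) (evenCeil-odd n)

2*-neg : ∀ x → (+ 2) ℤ.* -[1+ x ] ≡ -[1+ suc (2 * x) ]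
2*-neg x = cong -[1+_] (ℕP.+-suc x (x + 0))

∣2a+1∣ : ∀ a → ∣ (+ 2) ℤ.* a ℤ.+ ℤ.1ℤ ∣ ≡ suc (2 * fold a)
∣2a+1∣ (+ x) rewrite ℤP.pos-distrib-* 2 x = ℕP.+-comm (2 * x) 1
∣2a+1∣ -[1+ x ] = cong (λ z → ∣ z ℤ.+ ℤ.1ℤ ∣) (2*-neg x)

inAztec-folded : ∀ M a b → inAztec M (a , b) ≡ (suc (fold a + fold b) ≤ᵇ M)
inAztec-folded M a b rewrite ∣2a+1∣ a | ∣2a+1∣ b = doubled
  where
  x = fold a
  y = fold b
  eq : suc (2 * x) + suc (2 * y) ≡ 2 * suc (x + y)
  eq = begin
    suc (2 * x) + suc (2 * y)  ≡⟨ ℕP.+-suc (suc (2 * x)) (2 * y) ⟩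
    suc (suc (2 * x + 2 * y))  ≡⟨ cong (λ z → suc (suc z)) (ℕP.*-distribˡ-+ 2 x y) ⟨
    suc (suc (2 * (x + y)))    ≡⟨ cong suc (ℕP.+-suc (x + y) ((x + y) + 0)) ⟨
    2 * suc (x + y)            ∎
    where open ≡-Reasoning
  doubled : (suc (2 * x) + suc (2 * y) ≤ᵇ 2 * M) ≡ (suc (x + y) ≤ᵇ M)
  doubled with suc (x + y) ≤ᵇ M in k
  ... | true = ≤ᵇ-true (subst (_≤ 2 * M) (sym eq) (ℕP.*-monoʳ-≤ 2 (≤ᵇ-true⇒≤ (suc (x + y)) M k)))
  ... | false = ≤ᵇ-false (subst (2 * M <_) (sym eq) (ℕP.*-monoʳ-< 2 (≤ᵇ-false⇒> (suc (x + y)) M k)))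

∣⌈a/2⌉∣ : ∀ a → ∣ ⌈ a /2⌉ ∣ ≡ suc (fold a) / 2
∣⌈a/2⌉∣ (+ x) = refl
∣⌈a/2⌉∣ -[1+ x ] = ℤP.∣-i∣≡∣i∣ (+ (suc x / 2))

inKa : ℕ → Cell → Bool
inKa n c = inAztec n c ∧ ((+ (2 * ∣ ⌈ proj₁ c /2⌉ ∣)) ≤ᶻ proj₂ c)

inKna : ℕ → Cell → Bool
inKna n c = inAztec n c
          ∧ ((ℤ.- ((+ 2) ℤ.* ⌈ proj₁ c /2⌉)) ≤ᶻ proj₂ c)
          ∧ (proj₂ c ≤ᶻ ((+ 2) ℤ.* ⌈ proj₁ c /2⌉ ℤ.- ℤ.1ℤ))

inKa-upper : ∀ M a y → inKa M (a , + y) ≡ (suc (fold a + y) ≤ᵇ M) ∧ (evenCeil (fold a) ≤ᵇ y)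
inKa-upper M a y rewrite inAztec-folded M a (+ y) | ∣⌈a/2⌉∣ a | evenCeil-spec (fold a) =
  cong ((suc (fold a + y) ≤ᵇ M) ∧_) (≤ᶻ-pos (evenCeil (fold a)) y)

inKa-lower : ∀ M a y → inKa M (a , -[1+ y ]) ≡ false
inKa-lower M a y = BP.∧-zeroʳ _

within-± : ∀ e b → (((ℤ.- (+ e)) ≤ᶻ b) ∧ (b ≤ᶻ (+ e ℤ.- ℤ.1ℤ))) ≡ (suc (fold b) ≤ᵇ e)
within-± zero (+ y) = refl
within-± zero -[1+ y ] = refl
within-± (suc e) (+ zero) = ≤ᶻ-pos 0 e
within-± (suc e) (+ suc y) = ≤ᶻ-pos (suc y) e
within-± (suc e) -[1+ zero ] = cong (_∧ true) (≤ᶻ-neg e 0)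
within-± (suc e) -[1+ suc y ] = trans (BP.∧-identityʳ _) (≤ᶻ-neg e (suc y))

within-∓ : ∀ g b → (((ℤ.- ((+ 2) ℤ.* (ℤ.- (+ g)))) ≤ᶻ b) ∧ (b ≤ᶻ ((+ 2) ℤ.* (ℤ.- (+ g)) ℤ.- ℤ.1ℤ))) ≡ false
within-∓ zero (+ y) = refl
within-∓ zero -[1+ y ] = refl
within-∓ (suc g) b = trans (cong (λ z → ((ℤ.- z) ≤ᶻ b) ∧ (b ≤ᶻ (z ℤ.- ℤ.1ℤ))) (2*-neg g)) (negative (suc (2 * g)) b)
  where
  negative : ∀ k b → ((ℤ.- -[1+ k ]) ≤ᶻ b) ∧ (b ≤ᶻ (-[1+ k ] ℤ.- ℤ.1ℤ)) ≡ false
  negative k (+ y) = BP.∧-zeroʳ _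
  negative k -[1+ y ] = refl

inKna-right : ∀ M x b → inKna M (+ x , b) ≡ (suc (x + fold b) ≤ᵇ M) ∧ (suc (fold b) ≤ᵇ evenCeil x)
inKna-right M x b rewrite inAztec-folded M (+ x) b | ℤP.pos-distrib-* 2 (suc x / 2)
                        | within-± (2 * (suc x / 2)) b | evenCeil-spec x = refl

inKna-left : ∀ M x b → inKna M (-[1+ x ] , b) ≡ false
inKna-left M x b rewrite within-∓ (suc x / 2) b = BP.∧-zeroʳ _

coveredBy : List Domino → Cell → Bool
coveredBy [] p = false
coveredBy (w ∷ W) p = covers p w ∨ coveredBy W p

remaining : (Cell → Bool) → List Domino → Cell → Bool
remaining base W p = base p ∧ not (coveredBy W p)

remaining-kept : ∀ base W p → base p ≡ true → coveredBy W p ≡ false → remaining base W p ≡ true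
remaining-kept base W p b c rewrite b | c = refl

remaining-outside : ∀ base W p → base p ≡ false → remaining base W p ≡ false
remaining-outside base W p b rewrite b = refl

remaining-covered : ∀ base W p → coveredBy W p ≡ true → remaining base W p ≡ false
remaining-covered base W p c rewrite c = BP.∧-zeroʳ (base p)

Covered : List Domino → Cell → Set
Covered W p = Σ Domino (λ w → w ∈ W × (proj₁ w ≡ p ⊎ proj₂ w ≡ p))

coveredBy-true : ∀ W p → Covered W p → coveredBy W p ≡ true
coveredBy-true (w ∷ W) p (.w , here refl , inj₁ refl) rewrite covers-first (proj₁ w) (proj₂ w) = refl
coveredBy-true (w ∷ W) p (.w , here refl , inj₂ refl) rewrite covers-second (proj₁ w) (proj₂ w) = refl
coveredBy-true (w ∷ W) p (w' , there m , e) rewrite coveredBy-true W p (w' , m , e) = BP.∨-zeroʳ (covers p w)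

NotCellOf : Cell → Domino → Set
NotCellOf p w = (proj₁ w ≡ p → ⊥) × (proj₂ w ≡ p → ⊥)

coveredBy-false : ∀ W p → All (NotCellOf p) W → coveredBy W p ≡ false
coveredBy-false [] p [] = refl
coveredBy-false (w ∷ W) p ((n₁ , n₂) ∷ ns) rewrite coveredBy-false W p ns =
  trans (BP.∨-identityʳ (covers p w)) (≢true⇒false _ not-covered)
  where
  not-covered : covers p w ≡ true → ⊥
  not-covered k with covers-cases p (proj₁ w) (proj₂ w) k
  ... | inj₁ e = n₁ (sym e)
  ... | inj₂ e = n₂ (sym e)

aztec-box : ∀ M (Q : Cell → Bool) → (∀ p → Q p ≡ true → inAztec M p ≡ true) → Box M Q
aztec-box M Q inside (a , b) e =
    ℕP.<-≤-trans (s≤s (ℕP.m≤m+n (fold a) (fold b))) le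
  , ℕP.<-≤-trans (s≤s (ℕP.m≤n+m (fold b) (fold a))) le
  where
  le : suc (fold a + fold b) ≤ M
  le = ≤ᵇ-true⇒≤ _ _ (trans (sym (inAztec-folded M a b)) (inside (a , b) e))

SlotIn : (Cell → Bool) → Domino → Cell → Domino → Set
SlotIn Q w q e = (Q q ≡ false) ⊎ (e ≡ w)

peel : ∀ M (base : Cell → Bool) → Box M base → ∀ W (u : Cell) (d : Dir) (c : Cell) →
  c ≡ u ⊎ c ≡ neighbour d u →
  remaining base W u ≡ true → remaining base W (neighbour d u) ≡ true →
  ∀ qL qR qU qD → hstep qL ≡ c → hstep c ≡ qR → vstep c ≡ qU → vstep qD ≡ c →
  SlotIn (remaining base W) (u , neighbour d u) qL (qL , c) →
  SlotIn (remaining base W) (u , neighbour d u) qR (c , qR) →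
  SlotIn (remaining base W) (u , neighbour d u) qU (c , qU) →
  SlotIn (remaining base W) (u , neighbour d u) qD (qD , c) →
  T (filterᵇ (remaining base W) (grid M)) ≡ T (filterᵇ (remaining base ((u , neighbour d u) ∷ W)) (grid M))
peel M base box W u d c c∈w u∈ v∈ qL qR qU qD eL eR eU eD sL sR sU sD =
  trans (ForcedByNeighbours.forced-by-neighbours X (region-unique M Q) u d (member u u∈) (member (neighbour d u) v∈)
           c c∈w qL qR qU qD eL eR eU eD (slot sL) (slot sR) (slot sU) (slot sD))
        (cong T (trans (filterᵇ-filterᵇ Q _ (grid M))
                       (filterᵇ-cong _ _ (grid M) (λ p → regroup (base p) (coveredBy W p) (covers p w)))))
  where
  Q = remaining base W
  X = filterᵇ Q (grid M)
  w = (u , neighbour d u)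
  regroup : ∀ a b c → (a ∧ not b) ∧ not c ≡ a ∧ not (c ∨ b)
  regroup true true true = refl
  regroup true true false = refl
  regroup true false true = refl
  regroup true false false = refl
  regroup false b c = refl
  member : ∀ p → Q p ≡ true → p ∈ X
  member (a , b) e = region-∈ M Q a b e (proj₁ inBox) (proj₂ inBox)
    where
    inBox : fold a < M × fold b < M
    inBox = box (a , b) (∧-true-left e)
  slot : ∀ {q e} → SlotIn Q w q e → Slot X w q e
  slot {q} (inj₁ f) = inj₁ (region-∉ M Q q f)
  slot (inj₂ e) = inj₂ e

-- In folded coordinates both regions are "x + y < size" (A for the
-- larger size, Am for the smaller one) conjoined with the same quartering
-- condition E; the hypotheses say that W covers exactly the band between them.
remaining-final : ∀ A Am E c → (Am ≡ true → A ≡ true) → (E ≡ true → Am ≡ true → c ≡ false) →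
  (E ≡ true → A ≡ true → Am ≡ false → c ≡ true) → (A ∧ E) ∧ not c ≡ Am ∧ E
remaining-final A Am false c sub disj cov rewrite BP.∧-zeroʳ A | BP.∧-zeroʳ Am = refl
remaining-final A true true c sub disj cov rewrite sub refl | disj refl refl = refl
remaining-final true false true c sub disj cov rewrite cov refl refl refl = refl
remaining-final false false true c sub disj cov = refl

+1-inner : ∀ a b → a + (b + 1) ≡ suc (a + b)
+1-inner = solve-∀

+1-outer : ∀ a b → a + 1 + b ≡ suc (a + b)
+1-outer = solve-∀

≤-of-≡suc : ∀ {m k} → k ≡ suc m → m ≤ k
≤-of-≡suc refl = ℕP.n≤1+n _

level : Cell → ℕ
level q = fold (proj₁ q) + fold (proj₂ q)

AtLevel≥ : ℕ → Domino → Set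
AtLevel≥ m w = m ≤ level (proj₁ w) × m ≤ level (proj₂ w)

below-level-not-covered : ∀ m p W → level p < m → All (AtLevel≥ m) W → All (NotCellOf p) W
below-level-not-covered m p W lt =
  All.map (λ { (g₁ , g₂) → (λ { refl → ℕP.<⇒≱ lt g₁ }) , (λ { refl → ℕP.<⇒≱ lt g₂ }) })

UnderCell : ℕ → Cell → Set
UnderCell Y q = Σ ℕ (λ y' → proj₂ q ≡ + y' × y' < Y)

Under : ℕ → Domino → Set
Under Y w = UnderCell Y (proj₁ w) × UnderCell Y (proj₂ w)

under-not-covered : ∀ Y a W → All (Under Y) W → All (NotCellOf (a , + Y)) W
under-not-covered Y a W = All.map (λ { (u₁ , u₂) → misses u₁ , misses u₂ })
  where
  misses : ∀ {q} → UnderCell Y q → q ≡ (a , + Y) → ⊥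
  misses (y' , e , lt) refl = ℕP.<-irrefl (ℤP.+-injective (sym e)) lt

under-weaken : ∀ {Y Y'} → Y ≤ Y' → ∀ {W} → All (Under Y) W → All (Under Y') W
under-weaken le = All.map (λ { ((y₁ , e₁ , l₁) , (y₂ , e₂ , l₂)) →
  (y₁ , e₁ , ℕP.<-≤-trans l₁ le) , (y₂ , e₂ , ℕP.<-≤-trans l₂ le) })

Ka-box : ∀ M → Box M (inKa M)
Ka-box M = aztec-box M (inKa M) (λ p e → ∧-true-left e)

-- In folded coordinates Ka(m+2) ∖ Ka(m) is the set of cells with y ≥ evenCeil x
-- and x + y ∈ {m, m+1}.  Write m + 1 = h + R with h = evenCeil R ≥ 1.  At
-- height h + s (0 ≤ s ≤ R) the band consists of two horizontal dominoes: the
-- left one covers the columns a = -(r+1), -r with r = R - s, the right one the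
-- columns a = R - s - 1, R - s.  They are peeled height by height from the
-- bottom, left before right; each is forced by its outer cell, whose other
-- neighbours are outside Ka(m+2), below the line y = evenCeil x, or already
-- peeled.
module AbuttingBand (h' R m : ℕ) (hm : m ≡ h' + R) (hR : evenCeil R ≡ suc h') where

  h M : ℕ
  h = suc h'
  M = suc (suc m)

  base : Cell → Bool
  base = inKa M

  inKa-inside : ∀ a y → fold a + y ≤ suc m → evenCeil (fold a) ≤ y → inKa M (a , + y) ≡ true
  inKa-inside a y l₁ l₂ rewrite inKa-upper M a y | ≤ᵇ-true {suc (fold a + y)} {M} (s≤s l₁) | ≤ᵇ-true l₂ = refl

  inKa-beyond : ∀ a y → suc m < fold a + y → inKa M (a , + y) ≡ false
  inKa-beyond a y lt rewrite inKa-upper M a y | ≤ᵇ-false {suc (fold a + y)} {M} (s≤s lt) = refl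

  inKa-below-line : ∀ a y → y < evenCeil (fold a) → inKa M (a , + y) ≡ false
  inKa-below-line a y lt rewrite inKa-upper M a y | ≤ᵇ-false {evenCeil (fold a)} {y} lt = BP.∧-zeroʳ _

  level-band : ∀ r s → r + s ≡ R → r + (h + s) ≡ suc m
  level-band r s e = trans (swap r s) (trans (cong (λ z → h + z) e) (sym (cong suc hm)))
    where
    swap : ∀ r s → r + (h + s) ≡ h + (r + s)
    swap r s = trans (sym (ℕP.+-assoc r h s)) (trans (cong (λ z → z + s) (ℕP.+-comm r h)) (ℕP.+-assoc h r s))

  above-line : ∀ r s → r + s ≡ R → evenCeil r ≤ h + s
  above-line r s e = ℕP.≤-trans (evenCeil-mono (subst (r ≤_) e (ℕP.m≤m+n r s)))
    (ℕP.≤-trans (ℕP.≤-reflexive hR) (ℕP.m≤m+n h s))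

  leftCell rightCell : ℕ → ℕ → Cell
  leftCell r s = (-[1+ r ] , + (h + s))
  rightCell r s = (+ r , + (h + s))

  leftDom rightDom : ℕ → ℕ → Domino
  leftDom r s = (leftCell r s , hstep (leftCell r s))
  rightDom r s = (rightCell r s , hstep (rightCell r s))

  peeledBelow : ℕ → ℕ → List Domino → List Domino
  peeledBelow r zero W = W
  peeledBelow r (suc s) W = rightDom r s ∷ leftDom (suc r) s ∷ W

  peelOrder : ℕ → ℕ → List Domino → List Domino
  peelOrder zero s W = leftDom zero s ∷ W
  peelOrder (suc r) s W = peelOrder r (suc s) (rightDom r s ∷ leftDom (suc r) s ∷ W)

  Rest : List Domino → Region
  Rest W = filterᵇ (remaining base W) (grid M)

  fold-right-of-left : ∀ r → fold (-[1+ r ] ℤ.+ ℤ.1ℤ) ≤ r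
  fold-right-of-left zero = z≤n
  fold-right-of-left (suc r) = ℕP.n≤1+n r

  below-line-at-bottom : ∀ r → r ≡ R → h' < evenCeil r
  below-line-at-bottom r refl = subst (h' <_) (sym hR) (ℕP.n<1+n h')

  peel-left : ∀ r s W → r + s ≡ R → All (Under (h + s)) (peeledBelow r s W) →
    T (Rest (peeledBelow r s W)) ≡ T (Rest (leftDom r s ∷ peeledBelow r s W))
  peel-left r s W e under = peel M base (Ka-box M) P (leftCell r s) H (leftCell r s) (inj₁ refl) u∈ v∈
      (-[1+ suc r ] , + (h + s)) (hstep (leftCell r s)) (vstep (leftCell r s)) (qD s) refl refl refl (eD s)
      (inj₁ (remaining-outside base P _ (inKa-beyond -[1+ suc r ] (h + s) (ℕP.≤-reflexive (cong suc (sym (level-band r s e)))))))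
      (inj₂ refl)
      (inj₁ (remaining-outside base P _ (inKa-beyond -[1+ r ] (h + s + 1) above)))
      (sD s W e)
    where
    P = peeledBelow r s W
    u∈ : remaining base P (leftCell r s) ≡ true
    u∈ = remaining-kept base P _ (inKa-inside -[1+ r ] (h + s) (ℕP.≤-reflexive (level-band r s e)) (above-line r s e))
      (coveredBy-false P _ (under-not-covered (h + s) _ P under))
    v∈ : remaining base P (hstep (leftCell r s)) ≡ true
    v∈ = remaining-kept base P _
      (inKa-inside (-[1+ r ] ℤ.+ ℤ.1ℤ) (h + s)
        (ℕP.≤-trans (ℕP.+-monoˡ-≤ (h + s) (fold-right-of-left r)) (ℕP.≤-reflexive (level-band r s e)))
        (ℕP.≤-trans (evenCeil-mono (fold-right-of-left r)) (above-line r s e)))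
      (coveredBy-false P _ (under-not-covered (h + s) _ P under))
    above : suc m < r + (h + s + 1)
    above = subst (λ z → suc m < r + z) (ℕP.+-comm 1 (h + s))
      (subst (suc m <_) (sym (ℕP.+-suc r (h + s))) (s≤s (ℕP.≤-reflexive (sym (level-band r s e)))))
    qD : ℕ → Cell
    qD zero = (-[1+ r ] , + h')
    qD (suc s') = hstep (leftCell (suc r) s')
    eD : ∀ s → vstep (qD s) ≡ leftCell r s
    eD zero = cong (λ z → (-[1+ r ] , + z)) (trans (ℕP.+-comm h' 1) (sym (ℕP.+-identityʳ h)))
    eD (suc s') = cong (λ z → (-[1+ r ] , + z)) (trans (ℕP.+-comm (h + s') 1) (sym (ℕP.+-suc h s')))
    sD : ∀ s W → r + s ≡ R → SlotIn (remaining base (peeledBelow r s W)) (leftDom r s) (qD s) (qD s , leftCell r s)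
    sD zero W e = inj₁ (remaining-outside base W _
      (inKa-below-line -[1+ r ] h' (below-line-at-bottom r (trans (sym (ℕP.+-identityʳ r)) e))))
    sD (suc s') W e = inj₁ (remaining-covered base (peeledBelow r (suc s') W) (qD (suc s'))
      (coveredBy-true (peeledBelow r (suc s') W) (qD (suc s')) (leftDom (suc r) s' , there (here refl) , inj₂ refl)))

  peel-right : ∀ r s W → suc r + s ≡ R → All (Under (h + s)) (peeledBelow (suc r) s W) →
    T (Rest (leftDom (suc r) s ∷ peeledBelow (suc r) s W))
      ≡ T (Rest (rightDom r s ∷ leftDom (suc r) s ∷ peeledBelow (suc r) s W))
  peel-right r s W e under = peel M base (Ka-box M) P (rightCell r s) H c (inj₂ refl) u∈ v∈
      (rightCell r s) (hstep c) (vstep c) (qD s) refl refl refl (eD s)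
      (inj₂ refl)
      (inj₁ (remaining-outside base P (+ (r + 1 + 1) , + (h + s)) (inKa-beyond (+ (r + 1 + 1)) (h + s) right)))
      (inj₁ (remaining-outside base P (+ (r + 1) , + (h + s + 1)) (inKa-beyond (+ (r + 1)) (h + s + 1) above)))
      (sD s W e)
    where
    P = leftDom (suc r) s ∷ peeledBelow (suc r) s W
    c = hstep (rightCell r s)
    r+1 : r + 1 ≡ suc r
    r+1 = ℕP.+-comm r 1
    outer-level : r + 1 + (h + s) ≡ suc m
    outer-level = trans (cong (λ z → z + (h + s)) r+1) (level-band (suc r) s e)
    other-side : ∀ x → NotCellOf (+ x , + (h + s)) (leftDom (suc r) s)
    other-side x = (λ ()) , (λ ())
    u∈ : remaining base P (rightCell r s) ≡ true
    u∈ = remaining-kept base P (rightCell r s)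
      (inKa-inside (+ r) (h + s) (ℕP.≤-trans (ℕP.n≤1+n _) (ℕP.≤-reflexive (level-band (suc r) s e)))
        (ℕP.≤-trans (evenCeil-mono (ℕP.n≤1+n r)) (above-line (suc r) s e)))
      (coveredBy-false P (rightCell r s) (other-side r ∷ under-not-covered (h + s) (+ r) _ under))
    v∈ : remaining base P c ≡ true
    v∈ = remaining-kept base P c
      (inKa-inside (+ (r + 1)) (h + s) (ℕP.≤-reflexive outer-level)
        (subst (λ z → evenCeil z ≤ h + s) (sym r+1) (above-line (suc r) s e)))
      (coveredBy-false P c (other-side (r + 1) ∷ under-not-covered (h + s) (+ (r + 1)) _ under))
    right : suc m < r + 1 + 1 + (h + s)
    right = subst (suc m <_) (sym (+1-outer (r + 1) (h + s))) (s≤s (ℕP.≤-reflexive (sym outer-level)))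
    above : suc m < r + 1 + (h + s + 1)
    above = subst (suc m <_) (sym (+1-inner (r + 1) (h + s))) (s≤s (ℕP.≤-reflexive (sym outer-level)))
    qD : ℕ → Cell
    qD zero = (+ (r + 1) , + h')
    qD (suc s') = rightCell (suc r) s'
    eD : ∀ s → vstep (qD s) ≡ hstep (rightCell r s)
    eD zero = cong (λ z → (+ (r + 1) , + z)) (trans (ℕP.+-comm h' 1) (sym (ℕP.+-identityʳ h)))
    eD (suc s') = cong₂ (λ a z → (+ a , + z)) (sym r+1) (trans (ℕP.+-comm (h + s') 1) (sym (ℕP.+-suc h s')))
    sD : ∀ s W → suc r + s ≡ R →
      SlotIn (remaining base (leftDom (suc r) s ∷ peeledBelow (suc r) s W)) (rightDom r s) (qD s) (qD s , hstep (rightCell r s))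
    sD zero W e = inj₁ (remaining-outside base (leftDom (suc r) zero ∷ W) (+ (r + 1) , + h') (inKa-below-line (+ (r + 1)) h'
      (below-line-at-bottom (r + 1) (trans r+1 (trans (sym (ℕP.+-identityʳ (suc r))) e)))))
    sD (suc s') W e = inj₁ (remaining-covered base (leftDom (suc r) (suc s') ∷ peeledBelow (suc r) (suc s') W) (qD (suc s'))
      (coveredBy-true (leftDom (suc r) (suc s') ∷ peeledBelow (suc r) (suc s') W) (qD (suc s'))
        (rightDom (suc r) s' , there (here refl) , inj₁ refl)))

  peel-all : ∀ r s W → r + s ≡ R → All (Under (h + s)) (peeledBelow r s W) →
    T (Rest (peeledBelow r s W)) ≡ T (Rest (peelOrder r s (peeledBelow r s W)))
  peel-all zero s W e under = peel-left 0 s W e under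
  peel-all (suc r) s W e under = trans (peel-left (suc r) s W e under) (trans (peel-right r s W e under)
      (peel-all r (suc s) (peeledBelow (suc r) s W) (trans (ℕP.+-suc r s) e) under'))
    where
    lt : h + s < h + suc s
    lt = ℕP.+-monoʳ-< h (ℕP.n<1+n s)
    under' : All (Under (h + suc s)) (rightDom r s ∷ leftDom (suc r) s ∷ peeledBelow (suc r) s W)
    under' = ((h + s , refl , lt) , (h + s , refl , lt)) ∷ ((h + s , refl , lt) , (h + s , refl , lt))
           ∷ under-weaken (ℕP.<⇒≤ lt) under

  band : List Domino
  band = peelOrder R 0 []

  band-level : ∀ r s W → r + s ≡ R → All (AtLevel≥ m) W → All (AtLevel≥ m) (peelOrder r s W)
  band-level zero s W e ls = (≤-of-≡suc (level-band 0 s e) , ≤-of-≡suc (level-band 0 s e)) ∷ ls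
  band-level (suc r) s W e ls = band-level r (suc s) _ (trans (ℕP.+-suc r s) e)
    ((ℕP.≤-reflexive (sym (ℕP.suc-injective (level-band (suc r) s e)))
       , ≤-of-≡suc (trans (cong (λ z → z + (h + s)) (ℕP.+-comm r 1)) (level-band (suc r) s e)))
     ∷ (≤-of-≡suc (level-band (suc r) s e) , ℕP.≤-reflexive (sym (ℕP.suc-injective (level-band (suc r) s e))))
     ∷ ls)

  ∈peelOrder-keep : ∀ r s W {w} → w ∈ W → w ∈ peelOrder r s W
  ∈peelOrder-keep zero s W m = there m
  ∈peelOrder-keep (suc r) s W m = ∈peelOrder-keep r (suc s) _ (there (there m))

  leftDom∈peelOrder : ∀ r s W r₁ s₁ → r₁ + s₁ ≡ r + s → s ≤ s₁ → leftDom r₁ s₁ ∈ peelOrder r s W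
  leftDom∈peelOrder zero s W r₁ s₁ e le with ℕP.≤-antisym (subst (s₁ ≤_) e (ℕP.m≤n+m s₁ r₁)) le
  ... | refl with ℕP.+-cancelʳ-≡ s r₁ 0 e
  ...   | refl = here refl
  leftDom∈peelOrder (suc r) s W r₁ s₁ e le with ℕP.m≤n⇒m<n∨m≡n le
  ... | inj₁ lt = leftDom∈peelOrder r (suc s) _ r₁ s₁ (trans e (sym (ℕP.+-suc r s))) lt
  ... | inj₂ refl with ℕP.+-cancelʳ-≡ s r₁ (suc r) e
  ...   | refl = ∈peelOrder-keep r (suc s) _ (there (here refl))

  rightDom∈peelOrder : ∀ r s W r₁ s₁ → suc r₁ + s₁ ≡ r + s → s ≤ s₁ → rightDom r₁ s₁ ∈ peelOrder r s W
  rightDom∈peelOrder zero s W r₁ s₁ e le = ⊥-elim (ℕP.<⇒≱ (subst (s₁ <_) e (s≤s (ℕP.m≤n+m s₁ r₁))) le)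
  rightDom∈peelOrder (suc r) s W r₁ s₁ e le with ℕP.m≤n⇒m<n∨m≡n le
  ... | inj₁ lt = rightDom∈peelOrder r (suc s) _ r₁ s₁ (trans e (sym (ℕP.+-suc r s))) lt
  ... | inj₂ refl with ℕP.+-cancelʳ-≡ s (suc r₁) (suc r) e
  ...   | refl = ∈peelOrder-keep r (suc s) _ (here refl)

  band-covers : ∀ a y → evenCeil (fold a) ≤ y → fold a + y ≤ suc m → m ≤ fold a + y → Covered band (a , + y)
  band-covers a y line A Am with h ℕP.≤? y
  ... | no y≱h = ⊥-elim (ℕP.<⇒≱ (ℕP.≤-<-trans line y<h) h≤evenCeil)
    where
    y<h : y < h
    y<h = ℕP.≰⇒> y≱h
    R≤x : R ≤ fold a
    R≤x = ℕP.+-cancelʳ-≤ h' R (fold a) (subst (λ z → z ≤ fold a + h') (trans hm (ℕP.+-comm h' R))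
      (ℕP.≤-trans Am (ℕP.+-monoʳ-≤ (fold a) (ℕP.≤-pred y<h))))
    h≤evenCeil : h ≤ evenCeil (fold a)
    h≤evenCeil = subst (_≤ evenCeil (fold a)) hR (evenCeil-mono R≤x)
  ... | yes h≤y with ℕP.m≤n⇒∃[o]m+o≡n h≤y
  ...   | s , refl = by-column a on-diagonal
    where
    x = fold a
    upper : x + s ≤ R
    upper = ℕP.+-cancelˡ-≤ h (x + s) R (subst₂ _≤_ (rearrange x h s) (cong suc hm) A)
      where
      rearrange : ∀ x h s → x + (h + s) ≡ h + (x + s)
      rearrange = solve-∀
    lower : R ≤ suc (x + s)
    lower = ℕP.+-cancelˡ-≤ h' R (suc (x + s)) (subst₂ _≤_ hm (rearrange x h' s) Am)
      where
      rearrange : ∀ x h' s → x + (suc h' + s) ≡ h' + suc (x + s)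
      rearrange = solve-∀
    on-diagonal : x + s ≡ R ⊎ suc (x + s) ≡ R
    on-diagonal with ℕP.m≤n⇒m<n∨m≡n upper
    ... | inj₂ e = inj₁ e
    ... | inj₁ lt = inj₂ (ℕP.≤-antisym lt lower)
    at : ∀ {k} → k ≡ R → k ≡ R + 0
    at e = trans e (sym (ℕP.+-identityʳ R))
    by-column : ∀ a → fold a + s ≡ R ⊎ suc (fold a + s) ≡ R → Covered band (a , + (h + s))
    by-column -[1+ x ] (inj₁ e) = leftDom x s , leftDom∈peelOrder R 0 [] x s (at e) z≤n , inj₁ refl
    by-column -[1+ x ] (inj₂ e) = leftDom (suc x) s , leftDom∈peelOrder R 0 [] (suc x) s (at e) z≤n , inj₂ refl
    by-column (+ zero) (inj₁ e) = leftDom 0 s , leftDom∈peelOrder R 0 [] 0 s (at e) z≤n , inj₂ refl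
    by-column (+ suc x) (inj₁ e) = rightDom x s , rightDom∈peelOrder R 0 [] x s (at e) z≤n
      , inj₂ (cong (λ z → (+ z , + (h + s))) (ℕP.+-comm x 1))
    by-column (+ x) (inj₂ e) = rightDom x s , rightDom∈peelOrder R 0 [] x s (at e) z≤n , inj₁ refl

  rest-after-band : ∀ p → remaining base band p ≡ inKa m p
  rest-after-band (a , -[1+ y ]) = trans (remaining-outside base band _ (inKa-lower M a y)) (sym (inKa-lower m a y))
  rest-after-band (a , + y) rewrite inKa-upper M a y | inKa-upper m a y =
    remaining-final _ _ _ _
      (λ e → ≤ᵇ-true (ℕP.≤-trans (≤ᵇ-true⇒≤ _ _ e) (ℕP.≤-trans (ℕP.n≤1+n m) (ℕP.n≤1+n (suc m)))))
      (λ _ e → coveredBy-false band _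
        (below-level-not-covered m (a , + y) band (≤ᵇ-true⇒≤ _ _ e) (band-level R 0 [] (ℕP.+-identityʳ R) [])))
      (λ line A Am → coveredBy-true band _
        (band-covers a y (≤ᵇ-true⇒≤ _ _ line) (ℕP.≤-pred (≤ᵇ-true⇒≤ _ _ A)) (ℕP.≤-pred (≤ᵇ-false⇒> _ _ Am))))

  Ka-band : T (Ka (suc (suc m))) ≡ T (Ka m)
  Ka-band = begin
    T (Ka M)                               ≡⟨ cong T (filterᵇ-cong _ _ (grid M) (λ p → sym (BP.∧-identityʳ (base p)))) ⟩
    T (Rest [])                            ≡⟨ peel-all R 0 [] (ℕP.+-identityʳ R) [] ⟩
    T (Rest band)                          ≡⟨ cong T (filterᵇ-cong _ _ (grid M) rest-after-band) ⟩
    T (filterᵇ (inKa m) (grid M))          ≡⟨ cong T (shrink-grid-by-two m (inKa m) (Ka-box m)) ⟩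
    T (Ka m)                               ∎
    where open ≡-Reasoning

Kna-box : ∀ M → Box M (inKna M)
Kna-box M = aztec-box M (inKna M) (λ p e → ∧-true-left e)

LeftCell : ℕ → Cell → Set
LeftCell X q = Σ ℕ (λ x' → proj₁ q ≡ + x' × x' < X)

LeftOf : ℕ → Domino → Set
LeftOf X w = LeftCell X (proj₁ w) × LeftCell X (proj₂ w)

left-not-covered : ∀ X b W → All (LeftOf X) W → All (NotCellOf (+ X , b)) W
left-not-covered X b W = All.map (λ { (l₁ , l₂) → misses l₁ , misses l₂ })
  where
  misses : ∀ {q} → LeftCell X q → q ≡ (+ X , b) → ⊥
  misses (x' , e , lt) refl = ℕP.<-irrefl (ℤP.+-injective (sym e)) lt

left-weaken : ∀ {X X'} → X ≤ X' → ∀ {W} → All (LeftOf X) W → All (LeftOf X') W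
left-weaken le = All.map (λ { ((x₁ , e₁ , l₁) , (x₂ , e₂ , l₂)) →
  (x₁ , e₁ , ℕP.<-≤-trans l₁ le) , (x₂ , e₂ , ℕP.<-≤-trans l₂ le) })

level-cases : ∀ {a m} → a ≤ suc m → m ≤ a → a ≡ suc m ⊎ a ≡ m
level-cases le ge with ℕP.m≤n⇒m<n∨m≡n le
... | inj₂ e = inj₁ e
... | inj₁ lt = inj₂ (ℕP.≤-antisym (ℕP.≤-pred lt) ge)

-- In folded coordinates Kna(m+2) ∖ Kna(m) is the set of cells with a = x ≥ 0,
-- y < evenCeil x and x + y ∈ {m, m+1}.  Write m + 1 = x₀ + y₀ where x₀ is the
-- first column tall enough to meet the band: column x₀ - 1 has height
-- evenCeil (x₀ - 1) ≤ y₀, column x₀ has height evenCeil x₀ ≥ y₀ + 1.  In column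
-- x₀ + t (0 ≤ t < y₀) the band consists of a vertical domino at the top edge
-- and its mirror image at the bottom edge; in column m+1 = x₀ + y₀ it is the
-- single vertical domino at the tip.  The columns are peeled from left to
-- right, top before bottom, and the tip last.  Each domino is forced by its
-- cell farther from the axis b = -½: its neighbours other than its partner lie
-- outside Kna(m+2), below the quartering line in column x₀ - 1, or in a domino
-- peeled with the previous column.
module NonAbuttingBand (x₀' y₀' m : ℕ) (hm : suc m ≡ suc x₀' + suc y₀')
  (short : evenCeil x₀' ≤ suc y₀') (tall : suc (suc y₀') ≤ evenCeil (suc x₀')) where

  x₀ y₀ K M : ℕ
  x₀ = suc x₀'
  y₀ = suc y₀'
  K = x₀ + y₀
  M = suc (suc m)

  base : Cell → Bool
  base = inKna M

  inKna-inside : ∀ x b → x + fold b ≤ suc m → suc (fold b) ≤ evenCeil x → inKna M (+ x , b) ≡ true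
  inKna-inside x b l1 l2 rewrite inKna-right M x b | ≤ᵇ-true {suc (x + fold b)} {M} (s≤s l1) | ≤ᵇ-true l2 = refl

  inKna-beyond : ∀ x b → suc m < x + fold b → inKna M (+ x , b) ≡ false
  inKna-beyond x b lt rewrite inKna-right M x b | ≤ᵇ-false {suc (x + fold b)} {M} (s≤s lt) = refl

  inKna-above-line : ∀ x b → evenCeil x < suc (fold b) → inKna M (+ x , b) ≡ false
  inKna-above-line x b lt rewrite inKna-right M x b | ≤ᵇ-false {suc (fold b)} {evenCeil x} lt = BP.∧-zeroʳ _

  level-outer : ∀ r t → suc r + t ≡ y₀ → x₀ + t + suc r ≡ suc m
  level-outer r t e = trans (trans (ℕP.+-assoc x₀ t (suc r)) (cong (λ z → x₀ + z) (trans (ℕP.+-comm t (suc r)) e))) (sym hm)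

  level-inner-suc : ∀ r t → suc r + t ≡ y₀ → suc (x₀ + t + r) ≡ suc m
  level-inner-suc r t e = trans (sym (ℕP.+-suc (x₀ + t) r)) (level-outer r t e)

  level-inner : ∀ r t → suc r + t ≡ y₀ → x₀ + t + r ≡ m
  level-inner r t e = ℕP.suc-injective (level-inner-suc r t e)

  narrow : suc y₀' ≤ suc (suc x₀')
  narrow = ℕP.≤-trans (ℕP.≤-pred (ℕP.≤-trans tall (evenCeil-≤ (suc x₀')))) (ℕP.n≤1+n _)

  column-tall : ∀ r t → suc r + t ≡ y₀ → suc (suc r) ≤ evenCeil (x₀ + t)
  column-tall r zero e = subst₂ (λ a b → suc a ≤ evenCeil b) (sym (trans (sym (ℕP.+-identityʳ (suc r))) e)) (sym (ℕP.+-identityʳ x₀)) tall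
  column-tall r (suc t') e = ℕP.≤-trans le (evenCeil-≥ (x₀ + suc t'))
    where
    a1 : suc r + suc t' ≤ suc x₀
    a1 = subst (_≤ suc x₀) (sym e) narrow
    a2 : suc r ≤ x₀ + t'
    a2 = ℕP.≤-trans (ℕP.≤-trans (s≤s (ℕP.m≤m+n r t')) (ℕP.≤-reflexive (sym (ℕP.+-suc r t')))) (ℕP.≤-trans (ℕP.≤-pred a1) (ℕP.m≤m+n x₀ t'))
    le : suc (suc r) ≤ x₀ + suc t'
    le = subst (suc (suc r) ≤_) (sym (ℕP.+-suc x₀ t')) (s≤s a2)

  topCell bottomCell : ℕ → ℕ → Cell
  topCell r t = (+ (x₀ + t) , + r)
  bottomCell r t = (+ (x₀ + t) , -[1+ suc r ])

  topDom bottomDom : ℕ → ℕ → Domino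
  topDom r t = (topCell r t , vstep (topCell r t))
  bottomDom r t = (bottomCell r t , vstep (bottomCell r t))

  tipCell : Cell
  tipCell = (+ K , -[1+ 0 ])
  tipDom : Domino
  tipDom = (tipCell , vstep tipCell)

  peelOrder : ℕ → ℕ → List Domino → List Domino
  peelOrder zero t W = tipDom ∷ bottomDom 0 t ∷ topDom 0 t ∷ W
  peelOrder (suc r) t W = peelOrder r (suc t) (bottomDom (suc r) t ∷ topDom (suc r) t ∷ W)

  peeledLeft : ℕ → ℕ → List Domino → List Domino
  peeledLeft r zero W = W
  peeledLeft r (suc t) W = bottomDom (suc r) t ∷ topDom (suc r) t ∷ W

  Rest : List Domino → Region
  Rest W = filterᵇ (remaining base W) (grid M)

  column-left : ∀ {bound} t → x₀ + t < bound → ∀ r → LeftOf bound (topDom r t) × LeftOf bound (bottomDom r t)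
  column-left t lt r = ((x₀ + t , refl , lt) , (x₀ + t , refl , lt)) , ((x₀ + t , refl , lt) , (x₀ + t , refl , lt))

  peel-top : ∀ r t W → suc r + t ≡ y₀ → All (LeftOf (x₀ + t)) (peeledLeft r t W) →
    T (Rest (peeledLeft r t W)) ≡ T (Rest (topDom r t ∷ peeledLeft r t W))
  peel-top r t W e left = peel M base (Kna-box M) P (topCell r t) V c (inj₂ refl) u∈ v∈
      (qL t) (hstep c) (vstep c) (topCell r t) (eL t) refl refl refl
      (sL t W e left)
      (inj₁ (remaining-outside base P (+ (x₀ + t + 1) , + (r + 1)) (inKna-beyond (x₀ + t + 1) (+ (r + 1)) right)))
      (inj₁ (remaining-outside base P (+ (x₀ + t) , + (r + 1 + 1)) (inKna-beyond (x₀ + t) (+ (r + 1 + 1)) above)))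
      (inj₂ refl)
    where
    P = peeledLeft r t W
    c = vstep (topCell r t)
    r+1 : r + 1 ≡ suc r
    r+1 = ℕP.+-comm r 1
    outer-level : x₀ + t + (r + 1) ≡ suc m
    outer-level = trans (cong (λ z → x₀ + t + z) r+1) (level-outer r t e)
    right : suc m < x₀ + t + 1 + (r + 1)
    right = subst (suc m <_) (sym (+1-outer (x₀ + t) (r + 1))) (s≤s (ℕP.≤-reflexive (sym outer-level)))
    above : suc m < x₀ + t + (r + 1 + 1)
    above = subst (suc m <_) (sym (+1-inner (x₀ + t) (r + 1))) (s≤s (ℕP.≤-reflexive (sym outer-level)))
    u∈ : remaining base P (topCell r t) ≡ true
    u∈ = remaining-kept base P (topCell r t) (inKna-inside (x₀ + t) (+ r) (ℕP.≤-trans (ℕP.n≤1+n _) (ℕP.≤-reflexive (level-inner-suc r t e))) (ℕP.≤-trans (ℕP.n≤1+n (suc r)) (column-tall r t e)))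
      (coveredBy-false P _ (left-not-covered (x₀ + t) (+ r) P left))
    v∈ : remaining base P c ≡ true
    v∈ = remaining-kept base P c (inKna-inside (x₀ + t) (+ (r + 1)) (ℕP.≤-reflexive outer-level) (subst (λ z → suc z ≤ evenCeil (x₀ + t)) (sym r+1) (column-tall r t e)))
      (coveredBy-false P _ (left-not-covered (x₀ + t) (+ (r + 1)) P left))
    qL : ℕ → Cell
    qL zero = (+ x₀' , + (r + 1))
    qL (suc t') = topCell (suc r) t'
    eL : ∀ t → hstep (qL t) ≡ vstep (topCell r t)
    eL zero = cong (λ z → (+ z , + (r + 1))) (trans (ℕP.+-comm x₀' 1) (sym (ℕP.+-identityʳ x₀)))
    eL (suc t') = cong₂ (λ a z → (+ a , + z)) (trans (ℕP.+-assoc x₀ t' 1) (cong (λ z → x₀ + z) (ℕP.+-comm t' 1))) (sym r+1)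
    sL : ∀ t W → suc r + t ≡ y₀ → All (LeftOf (x₀ + t)) (peeledLeft r t W) → SlotIn (remaining base (peeledLeft r t W)) (topDom r t) (qL t) (qL t , vstep (topCell r t))
    sL zero W e left = inj₁ (remaining-outside base (peeledLeft r zero W) (qL zero) (inKna-above-line x₀' (+ (r + 1)) (subst (λ z → evenCeil x₀' < suc z) (sym (trans r+1 (trans (sym (ℕP.+-identityʳ (suc r))) e))) (s≤s short))))
    sL (suc t') W e left = inj₁ (remaining-covered base (peeledLeft r (suc t') W) (qL (suc t')) (coveredBy-true (peeledLeft r (suc t') W) (qL (suc t')) (topDom (suc r) t' , there (here refl) , inj₁ refl)))

  peel-bottom : ∀ r t W → suc r + t ≡ y₀ → All (LeftOf (x₀ + t)) (peeledLeft r t W) →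
    T (Rest (topDom r t ∷ peeledLeft r t W)) ≡ T (Rest (bottomDom r t ∷ topDom r t ∷ peeledLeft r t W))
  peel-bottom r t W e left = peel M base (Kna-box M) P (bottomCell r t) V (bottomCell r t) (inj₁ refl) u∈ v∈
      (qL t) (hstep (bottomCell r t)) (vstep (bottomCell r t)) (+ (x₀ + t) , -[1+ suc (suc r) ]) (eL t) refl refl refl
      (sL t W e left)
      (inj₁ (remaining-outside base P (+ (x₀ + t + 1) , -[1+ suc r ]) (inKna-beyond (x₀ + t + 1) -[1+ suc r ] right)))
      (inj₂ refl)
      (inj₁ (remaining-outside base P (+ (x₀ + t) , -[1+ suc (suc r) ]) (inKna-beyond (x₀ + t) -[1+ suc (suc r) ] below)))
    where
    P = topDom r t ∷ peeledLeft r t W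
    right : suc m < x₀ + t + 1 + suc r
    right = subst (suc m <_) (sym (+1-outer (x₀ + t) (suc r))) (s≤s (ℕP.≤-reflexive (sym (level-outer r t e))))
    below : suc m < x₀ + t + suc (suc r)
    below = subst (suc m <_) (sym (ℕP.+-suc (x₀ + t) (suc r))) (s≤s (ℕP.≤-reflexive (sym (level-outer r t e))))
    other-side : ∀ y → NotCellOf (+ (x₀ + t) , -[1+ y ]) (topDom r t)
    other-side y = (λ ()) , (λ ())
    u∈ : remaining base P (bottomCell r t) ≡ true
    u∈ = remaining-kept base P (bottomCell r t) (inKna-inside (x₀ + t) -[1+ suc r ] (ℕP.≤-reflexive (level-outer r t e)) (column-tall r t e))
      (coveredBy-false P _ (other-side (suc r) ∷ left-not-covered (x₀ + t) -[1+ suc r ] _ left))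
    v∈ : remaining base P (vstep (bottomCell r t)) ≡ true
    v∈ = remaining-kept base P (vstep (bottomCell r t)) (inKna-inside (x₀ + t) -[1+ r ] (ℕP.≤-trans (ℕP.n≤1+n _) (ℕP.≤-reflexive (level-inner-suc r t e))) (ℕP.≤-trans (ℕP.n≤1+n (suc r)) (column-tall r t e)))
      (coveredBy-false P _ (other-side r ∷ left-not-covered (x₀ + t) -[1+ r ] _ left))
    qL : ℕ → Cell
    qL zero = (+ x₀' , -[1+ suc r ])
    qL (suc t') = vstep (bottomCell (suc r) t')
    eL : ∀ t → hstep (qL t) ≡ bottomCell r t
    eL zero = cong (λ z → (+ z , -[1+ suc r ])) (trans (ℕP.+-comm x₀' 1) (sym (ℕP.+-identityʳ x₀)))
    eL (suc t') = cong (λ a → (+ a , -[1+ suc r ])) (trans (ℕP.+-assoc x₀ t' 1) (cong (λ z → x₀ + z) (ℕP.+-comm t' 1)))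
    sL : ∀ t W → suc r + t ≡ y₀ → All (LeftOf (x₀ + t)) (peeledLeft r t W) → SlotIn (remaining base (topDom r t ∷ peeledLeft r t W)) (bottomDom r t) (qL t) (qL t , bottomCell r t)
    sL zero W e left = inj₁ (remaining-outside base (topDom r zero ∷ peeledLeft r zero W) (qL zero) (inKna-above-line x₀' -[1+ suc r ] (subst (λ z → evenCeil x₀' < suc z) (sym (trans (sym (ℕP.+-identityʳ (suc r))) e)) (s≤s short))))
    sL (suc t') W e left = inj₁ (remaining-covered base (topDom r (suc t') ∷ peeledLeft r (suc t') W) (qL (suc t')) (coveredBy-true (topDom r (suc t') ∷ peeledLeft r (suc t') W) (qL (suc t')) (bottomDom (suc r) t' , there (here refl) , inj₂ refl)))

  K≡1+m : K ≡ suc m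
  K≡1+m = sym hm

  peel-tip : ∀ t W → suc 0 + t ≡ y₀ → All (LeftOf (x₀ + t)) (peeledLeft 0 t W) →
    T (Rest (bottomDom 0 t ∷ topDom 0 t ∷ peeledLeft 0 t W)) ≡ T (Rest (tipDom ∷ bottomDom 0 t ∷ topDom 0 t ∷ peeledLeft 0 t W))
  peel-tip t W e left = peel M base (Kna-box M) P tipCell V (vstep tipCell) (inj₂ refl) u∈ v∈
      (topCell 0 t) (hstep (vstep tipCell)) (vstep (vstep tipCell)) tipCell eL refl refl refl
      (inj₁ (remaining-covered base P (topCell 0 t) (coveredBy-true P (topCell 0 t) (topDom 0 t , there (here refl) , inj₁ refl))))
      (inj₁ (remaining-outside base P (+ (K + 1) , + 0) (inKna-beyond (K + 1) (+ 0) right)))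
      (inj₁ (remaining-outside base P (+ K , + 1) (inKna-beyond K (+ 1) above)))
      (inj₂ refl)
    where
    P = bottomDom 0 t ∷ topDom 0 t ∷ peeledLeft 0 t W
    next-column : x₀ + t + 1 ≡ K
    next-column = trans (ℕP.+-assoc x₀ t 1) (cong (λ z → x₀ + z) (trans (ℕP.+-comm t 1) e))
    lt : x₀ + t < K
    lt = subst (x₀ + t <_) next-column (subst (x₀ + t <_) (sym (ℕP.+-comm (x₀ + t) 1)) (ℕP.n<1+n (x₀ + t)))
    left-of-tip : All (LeftOf K) P
    left-of-tip = proj₂ (column-left t lt 0) ∷ proj₁ (column-left t lt 0) ∷ left-weaken (ℕP.<⇒≤ lt) left
    right : suc m < K + 1 + 0
    right = subst (suc m <_) (sym (trans (ℕP.+-identityʳ (K + 1)) (trans (ℕP.+-comm K 1) (cong suc K≡1+m)))) (ℕP.n<1+n (suc m))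
    above : suc m < K + 1
    above = subst (suc m <_) (sym (trans (ℕP.+-comm K 1) (cong suc K≡1+m))) (ℕP.n<1+n (suc m))
    tip-inside : K + 0 ≤ suc m
    tip-inside = ℕP.≤-reflexive (trans (ℕP.+-identityʳ K) K≡1+m)
    tip-below-line : 1 ≤ evenCeil K
    tip-below-line = ℕP.≤-trans (s≤s z≤n) (evenCeil-≥ K)
    u∈ : remaining base P tipCell ≡ true
    u∈ = remaining-kept base P tipCell (inKna-inside K -[1+ 0 ] tip-inside tip-below-line) (coveredBy-false P _ (left-not-covered K -[1+ 0 ] P left-of-tip))
    v∈ : remaining base P (vstep tipCell) ≡ true
    v∈ = remaining-kept base P (vstep tipCell) (inKna-inside K (+ 0) tip-inside tip-below-line) (coveredBy-false P _ (left-not-covered K (+ 0) P left-of-tip))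
    eL : hstep (topCell 0 t) ≡ vstep tipCell
    eL = cong (λ z → (+ z , + 0)) next-column

  peel-all : ∀ r t W → suc r + t ≡ y₀ → All (LeftOf (x₀ + t)) (peeledLeft r t W) → T (Rest (peeledLeft r t W)) ≡ T (Rest (peelOrder r t (peeledLeft r t W)))
  peel-all zero t W e left = trans (peel-top 0 t W e left) (trans (peel-bottom 0 t W e left) (peel-tip t W e left))
  peel-all (suc r) t W e left = trans (peel-top (suc r) t W e left) (trans (peel-bottom (suc r) t W e left)
      (peel-all r (suc t) (peeledLeft (suc r) t W) (trans (cong suc (ℕP.+-suc r t)) e) left'))
    where
    lt : x₀ + t < x₀ + suc t
    lt = ℕP.+-monoʳ-< x₀ (ℕP.n<1+n t)
    left' : All (LeftOf (x₀ + suc t)) (bottomDom (suc r) t ∷ topDom (suc r) t ∷ peeledLeft (suc r) t W)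
    left' = proj₂ (column-left t lt (suc r)) ∷ proj₁ (column-left t lt (suc r)) ∷ left-weaken (ℕP.<⇒≤ lt) left

  column-level : ∀ r t → suc r + t ≡ y₀ → AtLevel≥ m (topDom r t) × AtLevel≥ m (bottomDom r t)
  column-level r t e = (ℕP.≤-reflexive (sym (level-inner r t e)) , ≤-of-≡suc (trans (cong (λ z → x₀ + t + z) (ℕP.+-comm r 1)) (level-outer r t e)))
             , (≤-of-≡suc (level-outer r t e) , ℕP.≤-reflexive (sym (level-inner r t e)))

  tip-level : AtLevel≥ m tipDom
  tip-level = ≤-of-≡suc (trans (ℕP.+-identityʳ K) K≡1+m) , ≤-of-≡suc (trans (ℕP.+-identityʳ K) K≡1+m)

  band-level : ∀ r t W → suc r + t ≡ y₀ → All (AtLevel≥ m) W → All (AtLevel≥ m) (peelOrder r t W)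
  band-level zero t W e cs = tip-level ∷ proj₂ (column-level 0 t e) ∷ proj₁ (column-level 0 t e) ∷ cs
  band-level (suc r) t W e cs = band-level r (suc t) _ (trans (cong suc (ℕP.+-suc r t)) e) (proj₂ (column-level (suc r) t e) ∷ proj₁ (column-level (suc r) t e) ∷ cs)

  ∈peelOrder-keep : ∀ r t W {w} → w ∈ W → w ∈ peelOrder r t W
  ∈peelOrder-keep zero t W mm = there (there (there mm))
  ∈peelOrder-keep (suc r) t W mm = ∈peelOrder-keep r (suc t) _ (there (there mm))

  tipDom∈peelOrder : ∀ r t W → tipDom ∈ peelOrder r t W
  tipDom∈peelOrder zero t W = here refl
  tipDom∈peelOrder (suc r) t W = tipDom∈peelOrder r (suc t) _

  column∈peelOrder : ∀ r t W r₁ t₁ → r₁ + t₁ ≡ r + t → t ≤ t₁ → topDom r₁ t₁ ∈ peelOrder r t W × bottomDom r₁ t₁ ∈ peelOrder r t W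
  column∈peelOrder zero t W r₁ t₁ e le with ℕP.≤-antisym (subst (t₁ ≤_) e (ℕP.m≤n+m t₁ r₁)) le
  ... | refl with ℕP.+-cancelʳ-≡ t r₁ 0 e
  ...   | refl = there (there (here refl)) , there (here refl)
  column∈peelOrder (suc r) t W r₁ t₁ e le with ℕP.m≤n⇒m<n∨m≡n le
  ... | inj₁ lt = column∈peelOrder r (suc t) _ r₁ t₁ (trans e (sym (ℕP.+-suc r t))) lt
  ... | inj₂ refl with ℕP.+-cancelʳ-≡ t r₁ (suc r) e
  ...   | refl = ∈peelOrder-keep r (suc t) _ (there (here refl)) , ∈peelOrder-keep r (suc t) _ (here refl)

  band : List Domino
  band = peelOrder y₀' 0 []

  column∈band : ∀ r₁ t₁ → r₁ + t₁ ≡ y₀' → topDom r₁ t₁ ∈ band × bottomDom r₁ t₁ ∈ band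
  column∈band r₁ t₁ e = column∈peelOrder y₀' 0 [] r₁ t₁ (trans e (sym (ℕP.+-identityʳ y₀'))) z≤n

  -- The band does not rise above height y₀, because column x₀ - 1 is short.
  band-height : ∀ x b → suc (fold b) ≤ evenCeil x → x + fold b ≤ suc m → fold b ≤ y₀
  band-height x b line A with fold b ℕP.≤? y₀
  ... | yes le = le
  ... | no ¬le = ⊥-elim (ℕP.<⇒≱ (s≤s (ℕP.≤-trans (ℕP.≤-trans (evenCeil-mono x≤x₀') short) (ℕP.n≤1+n y₀)))
                                 (ℕP.≤-trans (s≤s above) line))
    where
    above : suc y₀ ≤ fold b
    above = ℕP.≰⇒> ¬le
    x≤x₀' : x ≤ x₀'
    x≤x₀' = ℕP.+-cancelʳ-≤ (suc y₀) x x₀' (ℕP.≤-trans (ℕP.+-monoʳ-≤ x above)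
      (ℕP.≤-trans A (ℕP.≤-reflexive (trans hm (sym (ℕP.+-suc x₀' y₀))))))

  -- At height 0 the band consists of the tip (level m+1) and the lowest cells
  -- of the last column x₀ + y₀' (level m).
  at-height-0 : ∀ x b → fold b ≡ 0 → x ≡ suc m ⊎ x ≡ m → Covered band (+ x , b)
  at-height-0 x (+ y) refl (inj₁ ex) =
    tipDom , tipDom∈peelOrder y₀' 0 [] , inj₂ (cong (λ z → (+ z , + 0)) (trans K≡1+m (sym ex)))
  at-height-0 x -[1+ y ] refl (inj₁ ex) =
    tipDom , tipDom∈peelOrder y₀' 0 [] , inj₁ (cong (λ z → (+ z , -[1+ 0 ])) (trans K≡1+m (sym ex)))
  at-height-0 x (+ y) refl (inj₂ ex) = topDom 0 y₀' , proj₁ (column∈band 0 y₀' refl)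
    , inj₁ (cong (λ z → (+ z , + 0)) (trans (sym (ℕP.+-identityʳ (x₀ + y₀'))) (trans (level-inner 0 y₀' refl) (sym ex))))
  at-height-0 x -[1+ y ] refl (inj₂ ex) = bottomDom 0 y₀' , proj₂ (column∈band 0 y₀' refl)
    , inj₂ (cong (λ z → (+ z , -[1+ 0 ])) (trans (sym (ℕP.+-identityʳ (x₀ + y₀'))) (trans (level-inner 0 y₀' refl) (sym ex))))

  -- At height r + 1 a band cell is the outer cell of a domino in column x₀ + t
  -- (level m+1) or the inner cell of a domino in column x₀ + t - 1 (level m);
  -- the latter needs t ≥ 1, column x₀ - 1 being short.
  at-height-suc : ∀ x b r t → fold b ≡ suc r → r + t ≡ y₀' → suc (fold b) ≤ evenCeil x →
    x + suc r ≡ suc m ⊎ x + suc r ≡ m → Covered band (+ x , b)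
  at-height-suc x b r t fb rt line (inj₁ ex) =
    outer b fb (ℕP.+-cancelʳ-≡ (suc r) x (x₀ + t) (trans ex (sym (level-outer r t (cong suc rt)))))
    where
    outer : ∀ b → fold b ≡ suc r → x ≡ x₀ + t → Covered band (+ x , b)
    outer (+ y) refl refl = topDom r t , proj₁ (column∈band r t rt) , inj₂ (cong (λ z → (+ (x₀ + t) , + z)) (ℕP.+-comm r 1))
    outer -[1+ y ] refl refl = bottomDom r t , proj₂ (column∈band r t rt) , inj₁ refl
  at-height-suc x b r zero fb rt line (inj₂ ex) =
    ⊥-elim (ℕP.<⇒≱ (s≤s (ℕP.≤-trans (evenCeil-mono (ℕP.≤-reflexive x≡x₀')) short))
      (subst (λ z → suc z ≤ evenCeil x) (trans fb (cong suc (trans (sym (ℕP.+-identityʳ r)) rt))) line))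
    where
    x≡x₀' : x ≡ x₀'
    x≡x₀' = ℕP.suc-injective (ℕP.+-cancelʳ-≡ r (suc x) x₀ (trans (sym (ℕP.+-suc x r))
      (trans ex (sym (trans (cong (λ z → z + r) (sym (ℕP.+-identityʳ x₀))) (level-inner r 0 (cong suc rt)))))))
  at-height-suc x b r (suc t') fb rt line (inj₂ ex) =
    inner b fb (ℕP.+-cancelʳ-≡ (suc r) x (x₀ + t') (trans ex (sym (level-inner (suc r) t' (cong suc rt')))))
    where
    rt' : suc r + t' ≡ y₀'
    rt' = trans (sym (ℕP.+-suc r t')) rt
    inner : ∀ b → fold b ≡ suc r → x ≡ x₀ + t' → Covered band (+ x , b)
    inner (+ y) refl refl = topDom (suc r) t' , proj₁ (column∈band (suc r) t' rt') , inj₁ refl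
    inner -[1+ y ] refl refl = bottomDom (suc r) t' , proj₂ (column∈band (suc r) t' rt') , inj₂ refl

  band-covers : ∀ x b → suc (fold b) ≤ evenCeil x → x + fold b ≤ suc m → m ≤ x + fold b → Covered band (+ x , b)
  band-covers x b line A Am = by-height (fold b) refl (band-height x b line A)
    where
    level-x : ∀ {y} → fold b ≡ y → x + y ≡ suc m ⊎ x + y ≡ m
    level-x fb = level-cases (subst (λ z → x + z ≤ suc m) fb A) (subst (λ z → m ≤ x + z) fb Am)
    by-height : ∀ y → fold b ≡ y → y ≤ y₀ → Covered band (+ x , b)
    by-height zero fb _ = at-height-0 x b fb (⊎-map (trans (sym (ℕP.+-identityʳ x))) (trans (sym (ℕP.+-identityʳ x))) (level-x fb))
    by-height (suc r) fb le with ℕP.m≤n⇒∃[o]m+o≡n (ℕP.≤-pred le)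
    ... | t , rt = at-height-suc x b r t fb rt line (level-x fb)

  rest-after-band : ∀ p → remaining base band p ≡ inKna m p
  rest-after-band (-[1+ x ] , b) = trans (remaining-outside base band _ (inKna-left M x b)) (sym (inKna-left m x b))
  rest-after-band (+ x , b) rewrite inKna-right M x b | inKna-right m x b =
    remaining-final _ _ _ _
      (λ e → ≤ᵇ-true (ℕP.≤-trans (≤ᵇ-true⇒≤ _ _ e) (ℕP.≤-trans (ℕP.n≤1+n m) (ℕP.n≤1+n (suc m)))))
      (λ _ e → coveredBy-false band _ (below-level-not-covered m (+ x , b) band (≤ᵇ-true⇒≤ _ _ e) (band-level y₀' 0 [] (cong suc (ℕP.+-identityʳ y₀')) [])))
      (λ E A Am → coveredBy-true band _ (band-covers x b (≤ᵇ-true⇒≤ _ _ E) (ℕP.≤-pred (≤ᵇ-true⇒≤ _ _ A)) (ℕP.≤-pred (≤ᵇ-false⇒> _ _ Am))))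

  Kna-band : T (Kna (suc (suc m))) ≡ T (Kna m)
  Kna-band = begin
    T (Kna M)                              ≡⟨ cong T (filterᵇ-cong _ _ (grid M) (λ p → sym (BP.∧-identityʳ (base p)))) ⟩
    T (Rest [])                            ≡⟨ peel-all y₀' 0 [] (cong suc (ℕP.+-identityʳ y₀')) [] ⟩
    T (Rest band)                          ≡⟨ cong T (filterᵇ-cong _ _ (grid M) rest-after-band) ⟩
    T (filterᵇ (inKna m) (grid M))         ≡⟨ cong T (shrink-grid-by-two m (inKna m) (Kna-box m)) ⟩
    T (Kna m)                              ∎
    where open ≡-Reasoning

Ka-shift : ∀ R m m' → suc m ≡ evenCeil R + R → suc (suc m) ≡ m' → T (Ka m) ≡ T (Ka m')
Ka-shift R m .(suc (suc m)) e refl with evenCeil R in eq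
... | suc h' = sym (AbuttingBand.Ka-band h' R m (ℕP.suc-injective e) eq)
... | zero with subst (_≤ 0) (sym e) (subst (R ≤_) eq (evenCeil-≥ R))
...   | ()

-- T(Kna m) = T(Kna (m+2)) whenever m + 1 = (x+1) + (y+1), where column x is too
-- short and column x+1 tall enough to reach the band (see 'NonAbuttingBand').
Kna-shift : ∀ x y m m' → suc m ≡ suc x + suc y → evenCeil x ≤ suc y → suc (suc y) ≤ evenCeil (suc x) →
  suc (suc m) ≡ m' → T (Kna m) ≡ T (Kna m')
Kna-shift x y m .(suc (suc m)) e short tall refl = sym (NonAbuttingBand.Kna-band x y m e short tall)

four-suc : ∀ k → 4 * suc k ≡ 4 + 4 * k
four-suc = solve-∀

Identities : ℕ → Set
Identities j = (T (Ka (j ∸ 2)) ≡ T (Ka j)) × (T (Ka (j ∸ 1)) ≡ T (Ka (j + 1)))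
             × (T (Kna j) ≡ T (Kna (j + 2))) × (T (Kna (j + 1)) ≡ T (Kna (j + 3)))

-- For j = 4k+4 they are instances of the two shift lemmas, with R = 2k+1,
-- R = 2k+2 for Ka and with (x , y) = (2k+2 , 2k+1), (2k+2 , 2k+2) for Kna.
identities : ∀ k → Identities (4 + 4 * k)
identities k =
    Ka-shift (suc (k + k)) (2 + 4 * k) (4 + 4 * k)
      (trans (ka₁ k) (cong (λ e → e + suc (k + k)) (sym (evenCeil-odd k)))) refl
  , Ka-shift (suc k + suc k) (3 + 4 * k) (4 + 4 * k + 1)
      (trans (ka₂ k) (cong (λ e → e + (suc k + suc k)) (sym (evenCeil-even (suc k))))) (ka₂' k)
  , Kna-shift (suc k + suc k) (suc (k + k)) (4 + 4 * k) (4 + 4 * k + 2) (kna₁ k)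
      (ℕP.≤-reflexive (trans (evenCeil-even (suc k)) (kna₁-short k)))
      (ℕP.≤-trans (ℕP.≤-reflexive (kna₁-tall k)) (evenCeil-≥ _)) (kna₁' k)
  , Kna-shift (suc k + suc k) (suc k + suc k) (4 + 4 * k + 1) (4 + 4 * k + 3) (kna₂ k)
      (ℕP.≤-trans (ℕP.≤-reflexive (evenCeil-even (suc k))) (ℕP.n≤1+n _))
      (ℕP.≤-reflexive (sym (evenCeil-odd (suc k)))) (kna₂' k)
  where
  ka₁ : ∀ k → suc (suc (suc (4 * k))) ≡ suc (suc (k + k)) + suc (k + k)
  ka₁ = solve-∀
  ka₂ : ∀ k → 4 + 4 * k ≡ (suc k + suc k) + (suc k + suc k)
  ka₂ = solve-∀
  ka₂' : ∀ k → 5 + 4 * k ≡ 4 + 4 * k + 1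
  ka₂' = solve-∀
  kna₁ : ∀ k → 5 + 4 * k ≡ suc (suc k + suc k) + suc (suc (k + k))
  kna₁ = solve-∀
  kna₁-short : ∀ k → suc k + suc k ≡ suc (suc (k + k))
  kna₁-short = solve-∀
  kna₁-tall : ∀ k → suc (suc (suc (k + k))) ≡ suc (suc k + suc k)
  kna₁-tall = solve-∀
  kna₁' : ∀ k → 6 + 4 * k ≡ 4 + 4 * k + 2
  kna₁' = solve-∀
  kna₂ : ∀ k → suc (4 + 4 * k + 1) ≡ suc (suc k + suc k) + suc (suc k + suc k)
  kna₂ = solve-∀
  kna₂' : ∀ k → suc (suc (4 + 4 * k + 1)) ≡ 4 + 4 * k + 3
  kna₂' = solve-∀

lemma2 : (n : ℕ) → 1 ≤ n →
    (T (Ka (4 * n ∸ 2)) ≡ T (Ka (4 * n)))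
    × (T (Ka (4 * n ∸ 1)) ≡ T (Ka (4 * n + 1)))
    × (T (Kna (4 * n)) ≡ T (Kna (4 * n + 2)))
    × (T (Kna (4 * n + 1)) ≡ T (Kna (4 * n + 3)))
lemma2 (suc k) _ = subst Identities (sym (four-suc k)) (identities k)
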